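{- Let $\sigma\in S_n$ and let $\Lambda$ be a growth associated with $\sigma$, with $P=P(\Lambda)$ and $Q=Q(\Lambda)$. Then $$\frac{(1-t)^n}{(1-q)^n}\,\mathcal{P}(\Lambda)=\overline{\mathcal{P}}(\Lambda)\,\psi_P(q,t)\,\varphi_Q(q,t).$$
   Context: Partitions are identified with their Young diagrams in French convention ($\lambda$ = cells $(x,y)\in\mathbb{Z}_{>0}^2$ with $x\le\lambda_y$; $\lambda'$ the conjugate). For $c=(x,y)\in\lambda$: $a_\lambda(c)=\lambda_y-x$, $\ell_\lambda(c)=\lambda'_x-y$; $n(\lambda)=\sum_c\ell_\lambda(c)$, $n'(\lambda)=\sum_c a_\lambda(c)$; $n(\rho/\kappa)=n(\rho)-n(\kappa)$, $n'(\rho/\kappa)=n'(\rho)-n'(\kappa)$. $\kappa\lessdot\rho$ means $\kappa\subseteq\rho$ with $\rho/\kappa$ one cell; $\mathcal{U}(\lambda)=\{\nu:\lambda\lessdot\nu\}$, $\mathcal{D}(\lambda)=\{\mu:\mu\lessdot\lambda\}$, $\mathcal{D}^*(\lambda)=\mathcal{D}(\lambda)\cup\{\lambda\}$. For $\kappa\lessdot\rho$, $\mathcal{R}_{\rho/\kappa}$ (resp. $\mathcal{C}_{\rho/\kappa}$) = cells of $\kappa$ in the same row (resp. column) as $\rho/\kappa$. Weights: $b_{i,j}=\frac{1-q^it^{j+1}}{1-q^{i+1}t^j}$, $b_\kappa(c)=b_{a_\kappa(c),\ell_\kappa(c)}$; for $\kappa\lessdot\rho$, $\psi_{\rho/\kappa}=\prod_{c\in\mathcal{R}_{\rho/\kappa}}b_\kappa(c)/b_\rho(c)$,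 $\varphi_{\rho/\kappa}=\frac{1-t}{1-q}\prod_{c\in\mathcal{C}_{\rho/\kappa}}b_\rho(c)/b_\kappa(c)$. A standard Young tableau $T$ of shape $\lambda\vdash n$ is identified with the chain $\emptyset=T^{(0)}\lessdot\dots\lessdot T^{(n)}=\lambda$, $T^{(i)}$ the shape of entries $\le i$; $\psi_T=\prod_i\psi_{T^{(i)}/T^{(i-1)}}$, $\varphi_T=\prod_i\varphi_{T^{(i)}/T^{(i-1)}}$. Local probabilities: with $[i,j]=1-q^it^j$, $\alpha_{\rho/\kappa}=\prod_{c\in\mathcal{R}_{\rho/\kappa}}\frac{[a_\kappa(c),\ell_\kappa(c)+1]}{[a_\rho(c),\ell_\rho(c)+1]}\prod_{c\in\mathcal{C}_{\rho/\kappa}}\frac{[a_\kappa(c)+1,\ell_\kappa(c)]}{[a_\rho(c)+1,\ell_\rho(c)]}$, $\overline{\alpha}_{\rho/\kappa}=\prod_{c\in\mathcal{R}_{\rho/\kappa}}\frac{[a_\kappa(c)+1,\ell_\kappa(c)]}{[a_\rho(c)+1,\ell_\rho(c)]}\prod_{c\in\mathcal{C}_{\rho/\kappa}}\frac{[a_\kappa(c),\ell_\kappa(c)+1]}{[a_\rho(c),\ell_\rho(c)+1]}$, $\beta=1/\alpha$, $\overline{\beta}=1/\overline{\alpha}$. For $\mu\in\mathcal{D}(\lambda)$, $\nu\in\mathcal{U}(\lambda)$, $N=n(\nu/\lambda)-n(\lambda/\mu)$, $M=n'(\lambda/\mu)-n'(\nu/\lambda)$, $\gamma_{\nu/\lambda/\mu}=\frac{(1-q^Mt^N)(1-q^{M+1}t^{N-1})}{(1-q)(1-t)}$.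 Set $\mathcal{P}_\lambda(\lambda\to\nu)=t^{n(\nu/\lambda)}\alpha_{\nu/\lambda}$, $\overline{\mathcal{P}}_\lambda(\lambda\leftarrow\nu)=t^{n(\nu/\lambda)}\overline{\alpha}_{\nu/\lambda}$, $\mathcal{P}_\lambda(\mu\to\nu)=t^{N-1}\alpha_{\nu/\lambda}\beta_{\lambda/\mu}/\gamma_{\nu/\lambda/\mu}$, $\overline{\mathcal{P}}_\lambda(\mu\leftarrow\nu)=t^{N-1}\overline{\alpha}_{\nu/\lambda}\overline{\beta}_{\lambda/\mu}/\gamma_{\nu/\lambda/\mu}$. Growths: for $\sigma\in S_n$, $A_\sigma$ is the $n\times n$ matrix with $1$ at (row $\sigma(j)$, column $j$), $0$ elsewhere. A growth associated with $\sigma$ labels each vertex $(i,j)$, $0\le i,j\le n$, by a partition $\Lambda_{ij}$ so that $\Lambda_{ij}\subseteq\Lambda_{i,j+1}$, $\Lambda_{ij}\subseteq\Lambda_{i+1,j}$, and $|\Lambda_{ij}|$ equals the number of $1$'s of $A_\sigma$ in positions $(i',j')$ with $i'\le i$, $j'\le j$. The chain $\Lambda_{0,n}\subseteq\dots\subseteq\Lambda_{n,n}$ defines the standard tableau $P(\Lambda)$ and $\Lambda_{n,0}\subseteq\dots\subseteq\Lambda_{n,n}$ defines $Q(\Lambda)$. For each square $1\le i,j\le n$ with corners $\mu=\Lambda_{i-1,j-1}$, $\rho=\Lambda_{i-1,j}$, $\lambda=\Lambda_{i,j-1}$, $\nu=\Lambda_{ij}$: if $\rho=\lambda$ and $\nu\ne\lambda$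 (then $\mu\in\mathcal{D}^*(\lambda)$, $\nu\in\mathcal{U}(\lambda)$), set $\mathcal{P}(\square)=\mathcal{P}_\lambda(\mu\to\nu)$, $\overline{\mathcal{P}}(\square)=\overline{\mathcal{P}}_\lambda(\mu\leftarrow\nu)$; otherwise both equal $1$. $\mathcal{P}(\Lambda)=\prod_\square\mathcal{P}(\square)$, $\overline{\mathcal{P}}(\Lambda)=\prod_\square\overline{\mathcal{P}}(\square)$. -}

module Defs where

open import Data.Nat as ℕ using (ℕ; zero; suc; _≤_; _<_; _≤?_; _<?_)
open import Data.Integer as ℤ using (ℤ; +_; -[1+_])
open import Data.Rational as ℚ using (ℚ; 0ℚ; 1ℚ; _*_; _-_; 1/_; ≢-nonZero)
open import Data.Rational.Properties using () renaming (_≟_ to _≟ℚ_)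
open import Data.Nat.ListAction using (sum)
open import Data.List using (List; []; _∷_; map; filter; length; upTo; concatMap; allFin; foldr)
open import Data.List.Properties using (≡-dec)
open import Data.Fin using (Fin; toℕ)
open import Data.Fin.Permutation using (Permutation′; _⟨$⟩ʳ_)
open import Data.Product using (_×_; _,_; proj₁; proj₂)
open import Relation.Nullary using (yes; no; ¬_)
open import Relation.Nullary.Decidable using (_×-dec_)
open import Relation.Binary.PropositionalEquality using (_≡_; _≢_)

Partition : Set
Partition = List ℕ

data Decreasing : List ℕ → Set where
  dec-[] : Decreasing []
  dec-[x] : ∀ {x} → Decreasing (x ∷ [])
  dec-∷ : ∀ {x y ys} → y ≤ x → Decreasing (y ∷ ys) → Decreasing (x ∷ y ∷ ys)

data AllPos : List ℕ → Set where
  pos-[] : AllPos []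
  pos-∷ : ∀ {x xs} → 1 ≤ x → AllPos xs → AllPos (x ∷ xs)

IsPartition : List ℕ → Set
IsPartition λ′ = Decreasing λ′ × AllPos λ′

-- λ_y, 1-indexed row length (0 outside)
part : Partition → ℕ → ℕ
part [] _ = 0
part (x ∷ xs) zero = 0
part (x ∷ xs) (suc zero) = x
part (x ∷ xs) (suc (suc k)) = part xs (suc k)

conj : Partition → ℕ → ℕ
conj λ′ x = length (filter (x ≤?_) λ′)

size : Partition → ℕ
size = sum

_⊆ₚ_ : Partition → Partition → Set
κ ⊆ₚ ρ = ∀ y → part κ y ≤ part ρ y

_≟ₚ_ : (κ ρ : Partition) → Relation.Nullary.Dec (κ ≡ ρ)
_≟ₚ_ = ≡-dec ℕ._≟_

range1 : ℕ → List ℕ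
range1 n = map suc (upTo n)

Cell : Set
Cell = ℕ × ℕ   -- (x , y) : column x, row y (French convention)

cells : Partition → List Cell
cells λ′ = concatMap (λ y → map (λ x → (x , y)) (range1 (part λ′ y))) (range1 (length λ′))

arm : Partition → Cell → ℕ
arm κ (x , y) = part κ y ℕ.∸ x

leg : Partition → Cell → ℕ
leg κ (x , y) = conj κ x ℕ.∸ y

n[_] : Partition → ℕ
n[ λ′ ] = sum (map (leg λ′) (cells λ′))

n′[_] : Partition → ℕ
n′[ λ′ ] = sum (map (arm λ′) (cells λ′))

nskew : Partition → Partition → ℤ
nskew ρ κ = (+ n[ ρ ]) ℤ.- (+ n[ κ ])

n′skew : Partition → Partition → ℤ
n′skew ρ κ = (+ n′[ ρ ]) ℤ.- (+ n′[ κ ])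

-- For κ ⋖ ρ: the row y of the cell ρ/κ (first row where they differ)
diffRow : Partition → Partition → ℕ
diffRow κ ρ with filter (λ y → part κ y <? part ρ y) (range1 (length ρ))
... | [] = 0
... | y ∷ _ = y

Rcells : Partition → Partition → List Cell
Rcells κ ρ = map (λ x → (x , diffRow κ ρ)) (range1 (part κ (diffRow κ ρ)))

Ccells : Partition → Partition → List Cell
Ccells κ ρ = map (λ y → (x , y)) (range1 (conj κ x))
  where x = part ρ (diffRow κ ρ)

-- Arithmetic in ℚ (evaluation of the rational functions at q, t)

inv : ℚ → ℚ
inv p with p ≟ℚ 0ℚ
... | yes _ = 0ℚ
... | no p≢0 = (1/ p) {{≢-nonZero p≢0}}

_÷_ : ℚ → ℚ → ℚ
p ÷ r = p * inv r

_^_ : ℚ → ℕ → ℚ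
p ^ zero = 1ℚ
p ^ suc k = p * (p ^ k)

_^ℤ_ : ℚ → ℤ → ℚ
p ^ℤ (+ k) = p ^ k
p ^ℤ -[1+ k ] = inv (p ^ suc k)

prodℚ : List ℚ → ℚ
prodℚ = foldr _*_ 1ℚ

module Weights (q t : ℚ) where

  br : ℕ → ℕ → ℚ
  br i j = 1ℚ - (q ^ i) * (t ^ j)

  b : ℕ → ℕ → ℚ
  b i j = br i (suc j) ÷ br (suc i) j

  bAt : Partition → Cell → ℚ
  bAt κ c = b (arm κ c) (leg κ c)

  ψ : Partition → Partition → ℚ
  ψ κ ρ = prodℚ (map (λ c → bAt κ c ÷ bAt ρ c) (Rcells κ ρ))

  φ : Partition → Partition → ℚ
  φ κ ρ = ((1ℚ - t) ÷ (1ℚ - q)) * prodℚ (map (λ c → bAt ρ c ÷ bAt κ c) (Ccells κ ρ))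

  α : Partition → Partition → ℚ
  α κ ρ = prodℚ (map (λ c → br (arm κ c) (suc (leg κ c)) ÷ br (arm ρ c) (suc (leg ρ c))) (Rcells κ ρ))
        * prodℚ (map (λ c → br (suc (arm κ c)) (leg κ c) ÷ br (suc (arm ρ c)) (leg ρ c)) (Ccells κ ρ))

  ᾱ : Partition → Partition → ℚ
  ᾱ κ ρ = prodℚ (map (λ c → br (suc (arm κ c)) (leg κ c) ÷ br (suc (arm ρ c)) (leg ρ c)) (Rcells κ ρ))
        * prodℚ (map (λ c → br (arm κ c) (suc (leg κ c)) ÷ br (arm ρ c) (suc (leg ρ c))) (Ccells κ ρ))

  β : Partition → Partition → ℚ
  β κ ρ = inv (α κ ρ)

  β̄ : Partition → Partition → ℚ
  β̄ κ ρ = inv (ᾱ κ ρ)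

  Nval : Partition → Partition → Partition → ℤ
  Nval ν λ′ μ = nskew ν λ′ ℤ.- nskew λ′ μ

  Mval : Partition → Partition → Partition → ℤ
  Mval ν λ′ μ = n′skew λ′ μ ℤ.- n′skew ν λ′

  γ : Partition → Partition → Partition → ℚ
  γ ν λ′ μ = ((1ℚ - (q ^ℤ M) * (t ^ℤ N)) * (1ℚ - (q ^ℤ (M ℤ.+ + 1)) * (t ^ℤ (N ℤ.- + 1))))
             ÷ ((1ℚ - q) * (1ℚ - t))
    where N = Nval ν λ′ μ
          M = Mval ν λ′ μ

  Pλ : Partition → Partition → Partition → ℚ
  Pλ λ′ μ ν with μ ≟ₚ λ′
  ... | yes _ = (t ^ℤ nskew ν λ′) * α λ′ ν
  ... | no _ = ((t ^ℤ (Nval ν λ′ μ ℤ.- + 1)) * α λ′ ν * β μ λ′) ÷ γ ν λ′ μ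

  P̄λ : Partition → Partition → Partition → ℚ
  P̄λ λ′ μ ν with μ ≟ₚ λ′
  ... | yes _ = (t ^ℤ nskew ν λ′) * ᾱ λ′ ν
  ... | no _ = ((t ^ℤ (Nval ν λ′ μ ℤ.- + 1)) * ᾱ λ′ ν * β̄ μ λ′) ÷ γ ν λ′ μ

  -- square weights: corners μ = Λ(i-1,j-1), ρ = Λ(i-1,j), λ = Λ(i,j-1), ν = Λ(i,j)
  Psq : Partition → Partition → Partition → Partition → ℚ
  Psq μ ρ λ′ ν with ρ ≟ₚ λ′ | ν ≟ₚ λ′
  ... | yes _ | no _ = Pλ λ′ μ ν
  ... | _ | _ = 1ℚ

  P̄sq : Partition → Partition → Partition → Partition → ℚ
  P̄sq μ ρ λ′ ν with ρ ≟ₚ λ′ | ν ≟ₚ λ′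
  ... | yes _ | no _ = P̄λ λ′ μ ν
  ... | _ | _ = 1ℚ

  PΛ : ℕ → (ℕ → ℕ → Partition) → ℚ
  PΛ n Λ = prodℚ (concatMap (λ i → map (λ j →
             Psq (Λ (i ℕ.∸ 1) (j ℕ.∸ 1)) (Λ (i ℕ.∸ 1) j) (Λ i (j ℕ.∸ 1)) (Λ i j)) (range1 n)) (range1 n))

  P̄Λ : ℕ → (ℕ → ℕ → Partition) → ℚ
  P̄Λ n Λ = prodℚ (concatMap (λ i → map (λ j →
             P̄sq (Λ (i ℕ.∸ 1) (j ℕ.∸ 1)) (Λ (i ℕ.∸ 1) j) (Λ i (j ℕ.∸ 1)) (Λ i j)) (range1 n)) (range1 n))

  -- ψ_T, φ_T for a standard tableau T given as its chain T(0) ⋖ … ⋖ T(n)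
  ψT : ℕ → (ℕ → Partition) → ℚ
  ψT n T = prodℚ (map (λ i → ψ (T (i ℕ.∸ 1)) (T i)) (range1 n))

  φT : ℕ → (ℕ → Partition) → ℚ
  φT n T = prodℚ (map (λ i → φ (T (i ℕ.∸ 1)) (T i)) (range1 n))

-- number of 1's of A_σ in positions (i', j') with i' ≤ i, j' ≤ j
-- (A_σ has a 1 at row σ(j), column j; Fin is 0-based)
countOnes : (n : ℕ) → Permutation′ n → ℕ → ℕ → ℕ
countOnes n σ i j =
  length (filter (λ j′ → (toℕ j′ <? j) ×-dec (toℕ (σ ⟨$⟩ʳ j′) <? i)) (allFin n))

IsGrowth : (n : ℕ) → Permutation′ n → (ℕ → ℕ → Partition) → Set
IsGrowth n σ Λ =
    (∀ i j → i ≤ n → j ≤ n → IsPartition (Λ i j))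
  × (∀ i j → i ≤ n → j < n → Λ i j ⊆ₚ Λ i (suc j))
  × (∀ i j → i < n → j ≤ n → Λ i j ⊆ₚ Λ (suc i) j)
  × (∀ i j → i ≤ n → j ≤ n → size (Λ i j) ≡ countOnes n σ i j)

Ptab : ℕ → (ℕ → ℕ → Partition) → (ℕ → Partition)
Ptab n Λ i = Λ i n

Qtab : ℕ → (ℕ → ℕ → Partition) → (ℕ → Partition)
Qtab n Λ j = Λ n j

Generic : ℚ → ℚ → Set
Generic q t = q ≢ 0ℚ × t ≢ 0ℚ ×
  (∀ (i j : ℤ) → ¬ (i ≡ + 0 × j ≡ + 0) → (q ^ℤ i) * (t ^ℤ j) ≢ 1ℚ)

module Submission where

-- Weight the edges Λ(i,j) → Λ(i+1,j) of the growth by ψ and the edges Λ(i,j) → Λ(i,j+1) by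
-- φ (1-q)/(1-t), or by 1 where the partition does not change. Every unit square with corners
-- μ = Λ(i-1,j-1), ρ = Λ(i-1,j), λ = Λ(i,j-1), ν = Λ(i,j) then satisfies the local identity
--   𝒫(□) ψ_{λ/μ} φ₁_{ρ/μ} = 𝒫̄(□) ψ_{ν/ρ} φ₁_{ν/λ}.
-- When a cell is created in the square, or μ ⋖ ρ = λ ⋖ ν, this is the cellwise identity
-- (1-t)/(1-q) α = ᾱ ψ φ; when two distinct cells are added, ψ and φ are products over a row and a
-- column whose factors agree on both sides except at the cell where that row meets that column.
-- In the product over all squares the interior edge weights cancel; the left and top boundaries are
-- empty, and the right and bottom boundaries are the chains of P and Q, which leave ψ_P and
-- φ_Q ((1-q)/(1-t))ⁿ.

open import Defs
open import Data.Nat as ℕ using (ℕ; zero; suc; _≤_; _<_; _≤?_; _<?_; z≤n; s≤s; _+_; _∸_)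
import Data.Nat.Properties as ℕ
import Data.Integer as ℤ
import Data.Integer.Properties as ℤ
open import Data.Rational using (ℚ; 0ℚ; 1ℚ; _*_; _-_; ≢-nonZero)
open import Data.Rational.Properties using (*-comm; *-assoc; *-identityˡ; *-identityʳ; *-zeroˡ; *-zeroʳ; *-inverseˡ; *-1-commutativeMonoid)
  renaming (_≟_ to _≟ℚ_)
open import Algebra.Bundles using (CommutativeMonoid)
open import Algebra.Properties.CommutativeSemigroup (CommutativeMonoid.commutativeSemigroup *-1-commutativeMonoid)
  using () renaming (interchange to *-interchange; xy∙z≈xz∙y to *-swapʳ; x∙yz≈y∙xz to *-swapˡ)
open import Algebra.Properties.CommutativeSemigroup ℕ.+-commutativeSemigroup
  using () renaming (interchange to +-interchange)
open import Data.Rational.Solver using (module +-*-Solver)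
open import Data.Bool using (true; false; if_then_else_)
open import Data.List using (List; []; _∷_; map; filter; length; upTo; applyUpTo; allFin; tabulate; concatMap; _++_)
open import Data.List.Properties using (map-++; map-∘; map-upTo; upTo-∷ʳ; map-tabulate; filter-accept; filter-reject; filter-none)
import Data.List.Relation.Unary.All as All
open import Data.Fin using (Fin; toℕ) renaming (zero to fzero; suc to fsuc)
import Data.Fin.Properties as Fin
open import Data.Fin.Permutation using (Permutation′; _⟨$⟩ʳ_; _⟨$⟩ˡ_; inverseˡ)
open import Data.Product using (∃; _×_; _,_; proj₁; proj₂)
open import Data.Sum using (_⊎_; inj₁; inj₂; map₁)
open import Data.Empty using (⊥; ⊥-elim)
open import Relation.Nullary using (Dec; yes; no; does; ¬_)
open import Relation.Nullary.Decidable using (_×-dec_)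
open import Level using (0ℓ)
open import Relation.Unary using (Pred; Decidable)
open import Relation.Unary.Properties using (_∩?_; ∅?)
open import Relation.Binary.PropositionalEquality
open +-*-Solver using (solve; _:*_; _:=_; _:-_; con)
open ≡-Reasoning

-- Arithmetic with the total inverse

inv-0 : inv 0ℚ ≡ 0ℚ
inv-0 with 0ℚ ≟ℚ 0ℚ
... | yes _ = refl
... | no 0≢0 = ⊥-elim (0≢0 refl)

inv-inverseˡ : ∀ {x} → x ≢ 0ℚ → inv x * x ≡ 1ℚ
inv-inverseˡ {x} x≢0 with x ≟ℚ 0ℚ
... | yes x≡0 = ⊥-elim (x≢0 x≡0)
... | no x≢0′ = *-inverseˡ x {{≢-nonZero x≢0′}}

inv-inverseʳ : ∀ {x} → x ≢ 0ℚ → x * inv x ≡ 1ℚ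
inv-inverseʳ {x} x≢0 = trans (*-comm x (inv x)) (inv-inverseˡ x≢0)

1≢0 : 1ℚ ≢ 0ℚ
1≢0 ()

*-cancelʳ-≡ : ∀ a b {c} → c ≢ 0ℚ → a * c ≡ b * c → a ≡ b
*-cancelʳ-≡ a b {c} c≢0 ac≡bc = begin
  a                ≡⟨ sym (*-identityʳ a) ⟩
  a * 1ℚ           ≡⟨ cong (a *_) (sym (inv-inverseʳ c≢0)) ⟩
  a * (c * inv c)  ≡⟨ sym (*-assoc a c (inv c)) ⟩
  (a * c) * inv c  ≡⟨ cong (_* inv c) ac≡bc ⟩
  (b * c) * inv c  ≡⟨ *-assoc b c (inv c) ⟩
  b * (c * inv c)  ≡⟨ cong (b *_) (inv-inverseʳ c≢0) ⟩
  b * 1ℚ           ≡⟨ *-identityʳ b ⟩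
  b                ∎

*-≢0 : ∀ {x y} → x ≢ 0ℚ → y ≢ 0ℚ → x * y ≢ 0ℚ
*-≢0 {x} {y} x≢0 y≢0 xy≡0 = y≢0 (*-cancelʳ-≡ y 0ℚ x≢0 (begin
  y * x  ≡⟨ *-comm y x ⟩
  x * y  ≡⟨ xy≡0 ⟩
  0ℚ     ≡⟨ sym (*-zeroˡ x) ⟩
  0ℚ * x ∎))

inv-≢0 : ∀ {x} → x ≢ 0ℚ → inv x ≢ 0ℚ
inv-≢0 {x} x≢0 inv≡0 = 1≢0 (trans (sym (inv-inverseˡ x≢0)) (trans (cong (_* x) inv≡0) (*-zeroˡ x)))

÷-≢0 : ∀ {x y} → x ≢ 0ℚ → y ≢ 0ℚ → x ÷ y ≢ 0ℚ
÷-≢0 x≢0 y≢0 = *-≢0 x≢0 (inv-≢0 y≢0)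

inv-distrib-* : ∀ x y → inv (x * y) ≡ inv x * inv y
inv-distrib-* x y = by-cases (x ≟ℚ 0ℚ) (y ≟ℚ 0ℚ)
  where
  by-cases : Dec (x ≡ 0ℚ) → Dec (y ≡ 0ℚ) → inv (x * y) ≡ inv x * inv y
  by-cases (yes refl) _ = begin
    inv (0ℚ * y)    ≡⟨ cong inv (*-zeroˡ y) ⟩
    inv 0ℚ          ≡⟨ inv-0 ⟩
    0ℚ              ≡⟨ sym (*-zeroˡ (inv y)) ⟩
    0ℚ * inv y      ≡⟨ cong (_* inv y) (sym inv-0) ⟩
    inv 0ℚ * inv y  ∎
  by-cases (no _) (yes refl) = begin
    inv (x * 0ℚ)    ≡⟨ cong inv (*-zeroʳ x) ⟩
    inv 0ℚ          ≡⟨ inv-0 ⟩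
    0ℚ              ≡⟨ sym (*-zeroʳ (inv x)) ⟩
    inv x * 0ℚ      ≡⟨ cong (inv x *_) (sym inv-0) ⟩
    inv x * inv 0ℚ  ∎
  by-cases (no x≢0) (no y≢0) = *-cancelʳ-≡ (inv (x * y)) (inv x * inv y) (*-≢0 x≢0 y≢0) (begin
    inv (x * y) * (x * y)     ≡⟨ inv-inverseˡ (*-≢0 x≢0 y≢0) ⟩
    1ℚ                        ≡⟨ sym (cong₂ _*_ (inv-inverseˡ x≢0) (inv-inverseˡ y≢0)) ⟩
    (inv x * x) * (inv y * y) ≡⟨ *-interchange (inv x) x (inv y) y ⟩
    (inv x * inv y) * (x * y) ∎)

inv-involutive : ∀ x → inv (inv x) ≡ x
inv-involutive x = by-cases (x ≟ℚ 0ℚ)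
  where
  by-cases : Dec (x ≡ 0ℚ) → inv (inv x) ≡ x
  by-cases (yes refl) = trans (cong inv inv-0) inv-0
  by-cases (no x≢0) = *-cancelʳ-≡ (inv (inv x)) x (inv-≢0 x≢0) (trans (inv-inverseˡ (inv-≢0 x≢0)) (sym (inv-inverseʳ x≢0)))

1-x≡0⇒x≡1 : ∀ {x} → 1ℚ - x ≡ 0ℚ → x ≡ 1ℚ
1-x≡0⇒x≡1 {x} 1-x≡0 = begin
  x              ≡⟨ solve 1 (λ x → x := con 1ℚ :- (con 1ℚ :- x)) refl x ⟩
  1ℚ - (1ℚ - x)  ≡⟨ cong (1ℚ -_) 1-x≡0 ⟩
  1ℚ             ∎

^-distrib-* : ∀ a b m → (a * b) ^ m ≡ (a ^ m) * (b ^ m)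
^-distrib-* a b zero = refl
^-distrib-* a b (suc m) = trans (cong ((a * b) *_) (^-distrib-* a b m))
  (*-interchange a b (a ^ m) (b ^ m))

1^m≡1 : ∀ m → 1ℚ ^ m ≡ 1ℚ
1^m≡1 zero = refl
1^m≡1 (suc m) = trans (*-identityˡ _) (1^m≡1 m)

^-≢0 : ∀ {a} m → a ≢ 0ℚ → a ^ m ≢ 0ℚ
^-≢0 zero a≢0 = 1≢0
^-≢0 (suc m) a≢0 = *-≢0 a≢0 (^-≢0 m a≢0)

inv-÷ : ∀ x y → inv (x ÷ y) ≡ inv x * y
inv-÷ x y = trans (inv-distrib-* x (inv y)) (cong (inv x *_) (inv-involutive y))

÷-split : ∀ a a′ {b b′} → b ≢ 0ℚ → b′ ≢ 0ℚ → a ÷ a′ ≡ (b ÷ b′) * ((a ÷ b) ÷ (a′ ÷ b′))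
÷-split a a′ {b} {b′} b≢0 b′≢0 = sym (begin
  (b * inv b′) * ((a * inv b) * inv (a′ * inv b′))    ≡⟨ cong (λ z → (b * inv b′) * ((a * inv b) * z)) (inv-÷ a′ b′) ⟩
  (b * inv b′) * ((a * inv b) * (inv a′ * b′))        ≡⟨ solve 6 (λ a ia′ b b′ ib ib′ → (b :* ib′) :* ((a :* ib) :* (ia′ :* b′)) := (a :* ia′) :* ((ib :* b) :* (ib′ :* b′))) refl a (inv a′) b b′ (inv b) (inv b′) ⟩
  (a * inv a′) * ((inv b * b) * (inv b′ * b′))        ≡⟨ cong₂ (λ u v → (a * inv a′) * (u * v)) (inv-inverseˡ b≢0) (inv-inverseˡ b′≢0) ⟩
  (a * inv a′) * (1ℚ * 1ℚ)                            ≡⟨ *-identityʳ _ ⟩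
  a * inv a′                                          ∎)

÷-flip : ∀ a b c d → (a ÷ b) ÷ (c ÷ d) ≡ (d ÷ c) ÷ (b ÷ a)
÷-flip a b c d = begin
  (a * inv b) * inv (c * inv d)   ≡⟨ cong ((a * inv b) *_) (inv-÷ c d) ⟩
  (a * inv b) * (inv c * d)       ≡⟨ solve 4 (λ a ib ic d → (a :* ib) :* (ic :* d) := (d :* ic) :* (ib :* a)) refl a (inv b) (inv c) d ⟩
  (d * inv c) * (inv b * a)       ≡⟨ cong ((d * inv c) *_) (sym (inv-÷ b a)) ⟩
  (d * inv c) * inv (b * inv a)   ∎

÷-telescope : ∀ a {b} c → b ≢ 0ℚ → (a ÷ b) * (b ÷ c) ≡ a ÷ c
÷-telescope a {b} c b≢0 = begin
  (a * inv b) * (b * inv c)   ≡⟨ *-interchange a (inv b) b (inv c) ⟩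
  (a * b) * (inv b * inv c)   ≡⟨ solve 4 (λ a b ib ic → (a :* b) :* (ib :* ic) := (a :* ic) :* (ib :* b)) refl a b (inv b) (inv c) ⟩
  (a * inv c) * (inv b * b)   ≡⟨ cong ((a * inv c) *_) (inv-inverseˡ b≢0) ⟩
  (a * inv c) * 1ℚ            ≡⟨ *-identityʳ _ ⟩
  a * inv c                   ∎

*-exchange : ∀ P₁ P₂ Q₁ Q₂ f₁ f₂ g₁ g₂ → f₂ * g₂ ≢ 0ℚ →
  P₁ * f₂ ≡ P₂ * f₁ → Q₁ * g₂ ≡ Q₂ * g₁ → f₁ * g₁ ≡ f₂ * g₂ → P₁ * Q₁ ≡ P₂ * Q₂
*-exchange P₁ P₂ Q₁ Q₂ f₁ f₂ g₁ g₂ f₂g₂≢0 P-eq Q-eq fg-eq = *-cancelʳ-≡ (P₁ * Q₁) (P₂ * Q₂) f₂g₂≢0 (begin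
  (P₁ * Q₁) * (f₂ * g₂)   ≡⟨ *-interchange P₁ Q₁ f₂ g₂ ⟩
  (P₁ * f₂) * (Q₁ * g₂)   ≡⟨ cong₂ _*_ P-eq Q-eq ⟩
  (P₂ * f₁) * (Q₂ * g₁)   ≡⟨ *-interchange P₂ f₁ Q₂ g₁ ⟩
  (P₂ * Q₂) * (f₁ * g₁)   ≡⟨ cong ((P₂ * Q₂) *_) fg-eq ⟩
  (P₂ * Q₂) * (f₂ * g₂)   ∎)

*-÷-cancel : ∀ {x} a → x ≢ 0ℚ → x * (a ÷ x) ≡ a
*-÷-cancel {x} a x≢0 = begin
  x * (a * inv x)  ≡⟨ *-swapˡ x a (inv x) ⟩
  a * (x * inv x)  ≡⟨ cong (a *_) (inv-inverseʳ x≢0) ⟩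
  a * 1ℚ           ≡⟨ *-identityʳ a ⟩
  a                ∎

prodℚ-++ : ∀ xs ys → prodℚ (xs ++ ys) ≡ prodℚ xs * prodℚ ys
prodℚ-++ [] ys = sym (*-identityˡ _)
prodℚ-++ (x ∷ xs) ys = trans (cong (x *_) (prodℚ-++ xs ys)) (sym (*-assoc x _ _))

prodℚ-concatMap : ∀ {A : Set} (f : A → List ℚ) xs →
  prodℚ (concatMap f xs) ≡ prodℚ (map (λ x → prodℚ (f x)) xs)
prodℚ-concatMap f [] = refl
prodℚ-concatMap f (x ∷ xs) = trans (prodℚ-++ (f x) (concatMap f xs)) (cong (prodℚ (f x) *_) (prodℚ-concatMap f xs))

prodℚ-map-≢0 : ∀ {A : Set} (f : A → ℚ) xs → (∀ x → f x ≢ 0ℚ) → prodℚ (map f xs) ≢ 0ℚ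
prodℚ-map-≢0 f [] f≢0 = 1≢0
prodℚ-map-≢0 f (x ∷ xs) f≢0 = *-≢0 (f≢0 x) (prodℚ-map-≢0 f xs f≢0)

prodℚ-map-* : ∀ {A : Set} (f g : A → ℚ) xs →
  prodℚ (map (λ x → f x * g x) xs) ≡ prodℚ (map f xs) * prodℚ (map g xs)
prodℚ-map-* f g [] = sym (*-identityˡ 1ℚ)
prodℚ-map-* f g (x ∷ xs) = begin
  (f x * g x) * prodℚ (map (λ x → f x * g x) xs)       ≡⟨ cong ((f x * g x) *_) (prodℚ-map-* f g xs) ⟩
  (f x * g x) * (prodℚ (map f xs) * prodℚ (map g xs))  ≡⟨ *-interchange (f x) (g x) _ _ ⟩
  (f x * prodℚ (map f xs)) * (g x * prodℚ (map g xs))  ∎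

prodℚ-map-cong : ∀ {A : Set} {f g : A → ℚ} xs → (∀ x → f x ≡ g x) → prodℚ (map f xs) ≡ prodℚ (map g xs)
prodℚ-map-cong [] f≗g = refl
prodℚ-map-cong (x ∷ xs) f≗g = cong₂ _*_ (f≗g x) (prodℚ-map-cong xs f≗g)

∏< : ℕ → (ℕ → ℚ) → ℚ
∏< m f = prodℚ (map f (upTo m))

prodℚ-range1 : ∀ m (f : ℕ → ℚ) → prodℚ (map f (range1 m)) ≡ ∏< m (λ a → f (suc a))
prodℚ-range1 m f = cong prodℚ (sym (map-∘ (upTo m)))

∏<-suc : ∀ m f → ∏< (suc m) f ≡ ∏< m f * f m
∏<-suc m f = begin
  prodℚ (map f (upTo (suc m)))            ≡⟨ cong (λ xs → prodℚ (map f xs)) (sym (upTo-∷ʳ m)) ⟩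
  prodℚ (map f (upTo m ++ m ∷ []))        ≡⟨ cong prodℚ (map-++ f (upTo m) (m ∷ [])) ⟩
  prodℚ (map f (upTo m) ++ f m ∷ [])      ≡⟨ prodℚ-++ (map f (upTo m)) (f m ∷ []) ⟩
  ∏< m f * (f m * 1ℚ)                     ≡⟨ cong (∏< m f *_) (*-identityʳ (f m)) ⟩
  ∏< m f * f m                            ∎

∏<-cong : ∀ m {f g} → (∀ a → a < m → f a ≡ g a) → ∏< m f ≡ ∏< m g
∏<-cong zero f≗g = refl
∏<-cong (suc m) {f} {g} f≗g = begin
  ∏< (suc m) f  ≡⟨ ∏<-suc m f ⟩
  ∏< m f * f m  ≡⟨ cong₂ _*_ (∏<-cong m (λ a a<m → f≗g a (ℕ.m<n⇒m<1+n a<m))) (f≗g m ℕ.≤-refl) ⟩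
  ∏< m g * g m  ≡⟨ sym (∏<-suc m g) ⟩
  ∏< (suc m) g  ∎

∏<-* : ∀ m f g → ∏< m (λ a → f a * g a) ≡ ∏< m f * ∏< m g
∏<-* m f g = prodℚ-map-* f g (upTo m)

∏<-≢0 : ∀ m f → (∀ a → f a ≢ 0ℚ) → ∏< m f ≢ 0ℚ
∏<-≢0 m f = prodℚ-map-≢0 f (upTo m)

∏<-const : ∀ m c → ∏< m (λ _ → c) ≡ c ^ m
∏<-const zero c = refl
∏<-const (suc m) c = begin
  ∏< (suc m) (λ _ → c)  ≡⟨ ∏<-suc m (λ _ → c) ⟩
  ∏< m (λ _ → c) * c    ≡⟨ cong (_* c) (∏<-const m c) ⟩
  (c ^ m) * c           ≡⟨ *-comm (c ^ m) c ⟩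
  c ^ suc m             ∎

∏<-telescope : ∀ m f → ∏< m (λ a → f (suc a)) * f 0 ≡ ∏< m f * f m
∏<-telescope zero f = refl
∏<-telescope (suc m) f = begin
  ∏< (suc m) f′ * f 0      ≡⟨ cong (_* f 0) (∏<-suc m f′) ⟩
  (∏< m f′ * f′ m) * f 0   ≡⟨ *-swapʳ (∏< m f′) (f′ m) (f 0) ⟩
  (∏< m f′ * f 0) * f′ m   ≡⟨ cong (_* f′ m) (∏<-telescope m f) ⟩
  (∏< m f * f m) * f′ m    ≡⟨ cong (_* f′ m) (sym (∏<-suc m f)) ⟩
  ∏< (suc m) f * f′ m      ∎
  where
  f′ : ℕ → ℚ
  f′ a = f (suc a)

∏<-swap : ∀ m l (F : ℕ → ℕ → ℚ) → ∏< m (λ i → ∏< l (F i)) ≡ ∏< l (λ j → ∏< m (λ i → F i j))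
∏<-swap zero l F = sym (trans (∏<-const l 1ℚ) (1^m≡1 l))
∏<-swap (suc m) l F = begin
  ∏< (suc m) (λ i → ∏< l (F i))                              ≡⟨ ∏<-suc m _ ⟩
  ∏< m (λ i → ∏< l (F i)) * ∏< l (F m)                       ≡⟨ cong (_* ∏< l (F m)) (∏<-swap m l F) ⟩
  ∏< l (λ j → ∏< m (λ i → F i j)) * ∏< l (F m)               ≡⟨ sym (∏<-* l _ (F m)) ⟩
  ∏< l (λ j → ∏< m (λ i → F i j) * F m j)                    ≡⟨ ∏<-cong l (λ j _ → sym (∏<-suc m (λ i → F i j))) ⟩
  ∏< l (λ j → ∏< (suc m) (λ i → F i j))                      ∎

∏<-except : ∀ m {f g} {a₀} → a₀ < m → (∀ a → a < m → a ≢ a₀ → f a ≡ g a) → ∏< m f * g a₀ ≡ ∏< m g * f a₀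
∏<-except (suc m) {f} {g} {a₀} a₀<1+m f≗g with ℕ.m≤n⇒m<n∨m≡n (ℕ.≤-pred a₀<1+m)
... | inj₂ refl = begin
  ∏< (suc m) f * g m     ≡⟨ cong (_* g m) (∏<-suc m f) ⟩
  (∏< m f * f m) * g m   ≡⟨ cong (λ p → (p * f m) * g m) (∏<-cong m (λ a a<m → f≗g a (ℕ.m<n⇒m<1+n a<m) (ℕ.<⇒≢ a<m))) ⟩
  (∏< m g * f m) * g m   ≡⟨ *-swapʳ (∏< m g) (f m) (g m) ⟩
  (∏< m g * g m) * f m   ≡⟨ cong (_* f m) (sym (∏<-suc m g)) ⟩
  ∏< (suc m) g * f m     ∎
... | inj₁ a₀<m = begin
  ∏< (suc m) f * g a₀     ≡⟨ cong (_* g a₀) (∏<-suc m f) ⟩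
  (∏< m f * f m) * g a₀   ≡⟨ *-swapʳ (∏< m f) (f m) (g a₀) ⟩
  (∏< m f * g a₀) * f m   ≡⟨ cong₂ _*_ (∏<-except m a₀<m (λ a a<m → f≗g a (ℕ.m<n⇒m<1+n a<m))) (f≗g m ℕ.≤-refl (ℕ.>⇒≢ a₀<m)) ⟩
  (∏< m g * f a₀) * g m   ≡⟨ *-swapʳ (∏< m g) (f a₀) (g m) ⟩
  (∏< m g * g m) * f a₀   ≡⟨ cong (_* f a₀) (sym (∏<-suc m g)) ⟩
  ∏< (suc m) g * f a₀     ∎

prodℚ-range1-cong : ∀ m {f g : ℕ → ℚ} → (∀ x → 1 ≤ x → x ≤ m → f x ≡ g x) →
  prodℚ (map f (range1 m)) ≡ prodℚ (map g (range1 m))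
prodℚ-range1-cong m {f} {g} f≗g = begin
  prodℚ (map f (range1 m))   ≡⟨ prodℚ-range1 m f ⟩
  ∏< m (λ a → f (suc a))     ≡⟨ ∏<-cong m (λ a a<m → f≗g (suc a) (s≤s z≤n) a<m) ⟩
  ∏< m (λ a → g (suc a))     ≡⟨ sym (prodℚ-range1 m g) ⟩
  prodℚ (map g (range1 m))   ∎

prodℚ-range1-except : ∀ m {f g : ℕ → ℚ} {x₀} → 1 ≤ x₀ → x₀ ≤ m → (∀ x → 1 ≤ x → x ≤ m → x ≢ x₀ → f x ≡ g x) →
  prodℚ (map f (range1 m)) * g x₀ ≡ prodℚ (map g (range1 m)) * f x₀
prodℚ-range1-except m {f} {g} {suc a₀} _ a₀<m f≗g = begin
  prodℚ (map f (range1 m)) * g (suc a₀)   ≡⟨ cong (_* g (suc a₀)) (prodℚ-range1 m f) ⟩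
  ∏< m (λ a → f (suc a)) * g (suc a₀)     ≡⟨ ∏<-except m a₀<m (λ a a<m a≢a₀ → f≗g (suc a) (s≤s z≤n) a<m (λ e → a≢a₀ (ℕ.suc-injective e))) ⟩
  ∏< m (λ a → g (suc a)) * f (suc a₀)     ≡⟨ cong (_* f (suc a₀)) (sym (prodℚ-range1 m g)) ⟩
  prodℚ (map g (range1 m)) * f (suc a₀)   ∎

prodℚ-crossing : ∀ m h {x₀ z₀} (F F′ G G′ : ℕ → ℚ) → 1 ≤ x₀ → 1 ≤ z₀ → (x₀ ≤ m → z₀ ≤ h) → (z₀ ≤ h → x₀ ≤ m) →
  (∀ x → 1 ≤ x → x ≢ x₀ → F x ≡ F′ x) → (∀ z → 1 ≤ z → z ≢ z₀ → G z ≡ G′ z) →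
  F′ x₀ * G′ z₀ ≢ 0ℚ → F x₀ * G z₀ ≡ F′ x₀ * G′ z₀ →
  prodℚ (map F (range1 m)) * prodℚ (map G (range1 h)) ≡ prodℚ (map F′ (range1 m)) * prodℚ (map G′ (range1 h))
prodℚ-crossing m h {x₀} {z₀} F F′ G G′ 1≤x₀ 1≤z₀ x₀-in⇒z₀-in z₀-in⇒x₀-in F≗F′ G≗G′ ≢0 crossing with x₀ ≤? m
... | yes x₀≤m = *-exchange (prodℚ (map F (range1 m))) (prodℚ (map F′ (range1 m))) (prodℚ (map G (range1 h))) (prodℚ (map G′ (range1 h)))
  (F x₀) (F′ x₀) (G z₀) (G′ z₀) ≢0
  (prodℚ-range1-except m {F} {F′} 1≤x₀ x₀≤m (λ x 1≤x _ → F≗F′ x 1≤x))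
  (prodℚ-range1-except h {G} {G′} 1≤z₀ (x₀-in⇒z₀-in x₀≤m) (λ z 1≤z _ → G≗G′ z 1≤z))
  crossing
... | no x₀≰m = cong₂ _*_
  (prodℚ-range1-cong m {F} {F′} (λ x 1≤x x≤m → F≗F′ x 1≤x (λ { refl → x₀≰m x≤m })))
  (prodℚ-range1-cong h {G} {G′} (λ z 1≤z z≤h → G≗G′ z 1≤z (λ { refl → x₀≰m (z₀-in⇒x₀-in z≤h) })))

-- Telescoping over the n × n grid

grid : ℕ → (ℕ → ℕ → ℚ) → ℚ
grid n F = ∏< n (λ i → ∏< n (F i))

grid-* : ∀ n F H → grid n (λ i j → F i j * H i j) ≡ grid n F * grid n H
grid-* n F H = trans (∏<-cong n (λ i _ → ∏<-* n (F i) (H i))) (∏<-* n _ _)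

grid-cong : ∀ n {F H} → (∀ i j → i < n → j < n → F i j ≡ H i j) → grid n F ≡ grid n H
grid-cong n F≗H = ∏<-cong n (λ i i<n → ∏<-cong n (λ j j<n → F≗H i j i<n j<n))

grid-≢0 : ∀ n F → (∀ i j → F i j ≢ 0ℚ) → grid n F ≢ 0ℚ
grid-≢0 n F F≢0 = ∏<-≢0 n _ (λ i → ∏<-≢0 n (F i) (F≢0 i))

grid-transpose : ∀ n F → grid n F ≡ grid n (λ i j → F j i)
grid-transpose n F = ∏<-swap n n F

grid-shiftʳ : ∀ n X → (∀ i → i < n → X i 0 ≡ 1ℚ) → grid n (λ i j → X i (suc j)) ≡ grid n X * ∏< n (λ i → X i n)
grid-shiftʳ n X X-left≡1 = trans (∏<-cong n row) (∏<-* n _ _)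
  where
  row : ∀ i → i < n → ∏< n (λ j → X i (suc j)) ≡ ∏< n (X i) * X i n
  row i i<n = begin
    ∏< n (λ j → X i (suc j))          ≡⟨ sym (*-identityʳ _) ⟩
    ∏< n (λ j → X i (suc j)) * 1ℚ     ≡⟨ cong (∏< n (λ j → X i (suc j)) *_) (sym (X-left≡1 i i<n)) ⟩
    ∏< n (λ j → X i (suc j)) * X i 0  ≡⟨ ∏<-telescope n (X i) ⟩
    ∏< n (X i) * X i n                ∎

grid-shiftˡ : ∀ n Y → (∀ j → j < n → Y 0 j ≡ 1ℚ) → grid n (λ i j → Y (suc i) j) ≡ grid n Y * ∏< n (λ j → Y n j)
grid-shiftˡ n Y Y-top≡1 = begin
  grid n (λ i j → Y (suc i) j)                     ≡⟨ grid-transpose n _ ⟩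
  grid n (λ j i → Y (suc i) j)                     ≡⟨ grid-shiftʳ n (λ j i → Y i j) Y-top≡1 ⟩
  grid n (λ j i → Y i j) * ∏< n (λ j → Y n j)      ≡⟨ cong (_* ∏< n (λ j → Y n j)) (sym (grid-transpose n Y)) ⟩
  grid n Y * ∏< n (λ j → Y n j)                    ∎

-- A discrete Stokes formula: the interior edge weights X, Y cancel and only the far boundary survives.
grid-telescope : ∀ n (S S̄ X Y : ℕ → ℕ → ℚ) → (∀ i j → X i j ≢ 0ℚ) → (∀ i j → Y i j ≢ 0ℚ) →
  (∀ i → i < n → X i 0 ≡ 1ℚ) → (∀ j → j < n → Y 0 j ≡ 1ℚ) →
  (∀ i j → i < n → j < n → S i j * (X i j * Y i j) ≡ S̄ i j * (X i (suc j) * Y (suc i) j)) →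
  grid n S ≡ grid n S̄ * (∏< n (λ i → X i n) * ∏< n (λ j → Y n j))
grid-telescope n S S̄ X Y X≢0 Y≢0 X-left≡1 Y-top≡1 local =
  *-cancelʳ-≡ (grid n S) (grid n S̄ * (∂X * ∂Y)) (*-≢0 (grid-≢0 n X X≢0) (grid-≢0 n Y Y≢0)) (begin
    grid n S * (grid n X * grid n Y)                                      ≡⟨ cong (grid n S *_) (sym (grid-* n X Y)) ⟩
    grid n S * grid n (λ i j → X i j * Y i j)                             ≡⟨ sym (grid-* n S _) ⟩
    grid n (λ i j → S i j * (X i j * Y i j))                              ≡⟨ grid-cong n local ⟩
    grid n (λ i j → S̄ i j * (X i (suc j) * Y (suc i) j))                  ≡⟨ grid-* n S̄ _ ⟩
    grid n S̄ * grid n (λ i j → X i (suc j) * Y (suc i) j)                 ≡⟨ cong (grid n S̄ *_) (grid-* n _ _) ⟩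
    grid n S̄ * (grid n (λ i j → X i (suc j)) * grid n (λ i j → Y (suc i) j))  ≡⟨ cong₂ (λ u v → grid n S̄ * (u * v)) (grid-shiftʳ n X X-left≡1) (grid-shiftˡ n Y Y-top≡1) ⟩
    grid n S̄ * ((grid n X * ∂X) * (grid n Y * ∂Y))                        ≡⟨ solve 5 (λ s x ∂x y ∂y → s :* ((x :* ∂x) :* (y :* ∂y)) := (s :* (∂x :* ∂y)) :* (x :* y)) refl (grid n S̄) (grid n X) ∂X (grid n Y) ∂Y ⟩
    (grid n S̄ * (∂X * ∂Y)) * (grid n X * grid n Y)                        ∎)
  where
  ∂X ∂Y : ℚ
  ∂X = ∏< n (λ i → X i n)
  ∂Y = ∏< n (λ j → Y n j)

prodℚ-squares : ∀ n (h : ℕ → ℕ → ℚ) →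
  prodℚ (concatMap (λ i → map (λ j → h i j) (range1 n)) (range1 n)) ≡ grid n (λ i j → h (suc i) (suc j))
prodℚ-squares n h = begin
  prodℚ (concatMap (λ i → map (h i) (range1 n)) (range1 n))   ≡⟨ prodℚ-concatMap (λ i → map (h i) (range1 n)) (range1 n) ⟩
  prodℚ (map (λ i → prodℚ (map (h i) (range1 n))) (range1 n)) ≡⟨ prodℚ-range1 n _ ⟩
  ∏< n (λ i → prodℚ (map (h (suc i)) (range1 n)))             ≡⟨ ∏<-cong n (λ i _ → prodℚ-range1 n (h (suc i))) ⟩
  grid n (λ i j → h (suc i) (suc j))                          ∎

indicator : ∀ {P : Set} → Dec P → ℕ
indicator P? = if does P? then 1 else 0

indicator-yes : ∀ {P : Set} → P → (P? : Dec P) → indicator P? ≡ 1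
indicator-yes p (yes _) = refl
indicator-yes p (no ¬p) = ⊥-elim (¬p p)

indicator-no : ∀ {P : Set} → ¬ P → (P? : Dec P) → indicator P? ≡ 0
indicator-no ¬p (yes p) = ⊥-elim (¬p p)
indicator-no ¬p (no _) = refl

indicator-mono : ∀ {P Q : Set} → (P → Q) → (P? : Dec P) (Q? : Dec Q) → indicator P? ≤ indicator Q?
indicator-mono P⇒Q (yes p) (yes _) = ℕ.≤-refl
indicator-mono P⇒Q (yes p) (no ¬q) = ⊥-elim (¬q (P⇒Q p))
indicator-mono P⇒Q (no _) Q? = z≤n

indicator-cong : ∀ {P Q : Set} → (P → Q) → (Q → P) → (P? : Dec P) (Q? : Dec Q) → indicator P? ≡ indicator Q?
indicator-cong P⇒Q Q⇒P P? Q? = ℕ.≤-antisym (indicator-mono P⇒Q P? Q?) (indicator-mono Q⇒P Q? P?)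

indicator-⊎ : ∀ {P Q R : Set} → (P → Q ⊎ R) → (P? : Dec P) (Q? : Dec Q) (R? : Dec R) →
  indicator P? ≤ indicator Q? + indicator R?
indicator-⊎ P⇒Q⊎R (no _) Q? R? = z≤n
indicator-⊎ P⇒Q⊎R (yes p) (yes _) R? = s≤s z≤n
indicator-⊎ P⇒Q⊎R (yes p) (no _) (yes _) = s≤s z≤n
indicator-⊎ P⇒Q⊎R (yes p) (no ¬q) (no ¬r) with P⇒Q⊎R p
... | inj₁ q = ⊥-elim (¬q q)
... | inj₂ r = ⊥-elim (¬r r)

indicator-supermodular : ∀ {P P′ Q Q′ : Set} → (P → P′) → (Q → Q′) →
  (P? : Dec P) (P′? : Dec P′) (Q? : Dec Q) (Q′? : Dec Q′) →
  indicator (P′? ×-dec Q?) + indicator (P? ×-dec Q′?) ≤ indicator (P? ×-dec Q?) + indicator (P′? ×-dec Q′?)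
indicator-supermodular P⇒P′ Q⇒Q′ (yes p) (no ¬p′) Q? Q′? = ⊥-elim (¬p′ (P⇒P′ p))
indicator-supermodular P⇒P′ Q⇒Q′ (yes p) (yes _) Q? Q′? = ℕ.≤-refl
indicator-supermodular P⇒P′ Q⇒Q′ (no _) (no _) Q? Q′? = z≤n
indicator-supermodular P⇒P′ Q⇒Q′ (no _) (yes _) (no _) Q′? = z≤n
indicator-supermodular P⇒P′ Q⇒Q′ (no _) (yes _) (yes q) (yes _) = ℕ.≤-refl
indicator-supermodular P⇒P′ Q⇒Q′ (no _) (yes _) (yes q) (no ¬q′) = ⊥-elim (¬q′ (Q⇒Q′ q))

private variable A₁ A₂ : Set

count : ∀ {P : Pred A₁ 0ℓ} → Decidable P → List A₁ → ℕ
count P? xs = length (filter P? xs)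

count-∷ : ∀ {P : Pred A₁ 0ℓ} (P? : Decidable P) x xs → count P? (x ∷ xs) ≡ indicator (P? x) + count P? xs
count-∷ P? x xs with does (P? x)
... | true = refl
... | false = refl

count-∅ : (xs : List A₁) → count (∅? {A = A₁}) xs ≡ 0
count-∅ [] = refl
count-∅ (x ∷ xs) = count-∅ xs

count-none : ∀ {P : Pred A₁ 0ℓ} (P? : Decidable P) xs → (∀ x → ¬ P x) → count P? xs ≡ 0
count-none P? [] ¬P = refl
count-none P? (x ∷ xs) ¬P with P? x
... | yes p = ⊥-elim (¬P x p)
... | no _ = count-none P? xs ¬P

count-map : ∀ {P : Pred A₂ 0ℓ} (P? : Decidable P) (f : A₁ → A₂) xs →
  count P? (map f xs) ≡ count (λ x → P? (f x)) xs
count-map P? f [] = refl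
count-map P? f (x ∷ xs) = begin
  count P? (f x ∷ map f xs)                         ≡⟨ count-∷ P? (f x) (map f xs) ⟩
  indicator (P? (f x)) + count P? (map f xs)         ≡⟨ cong (indicator (P? (f x)) +_) (count-map P? f xs) ⟩
  indicator (P? (f x)) + count (λ x → P? (f x)) xs   ≡⟨ sym (count-∷ (λ x → P? (f x)) x xs) ⟩
  count (λ x → P? (f x)) (x ∷ xs)                    ∎

count-mono₂ : ∀ {P Q R S : Pred A₁ 0ℓ} (P? : Decidable P) (Q? : Decidable Q) (R? : Decidable R) (S? : Decidable S) xs →
  (∀ x → indicator (P? x) + indicator (Q? x) ≤ indicator (R? x) + indicator (S? x)) →
  count P? xs + count Q? xs ≤ count R? xs + count S? xs
count-mono₂ P? Q? R? S? [] pointwise = z≤n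
count-mono₂ P? Q? R? S? (x ∷ xs) pointwise
  rewrite count-∷ P? x xs | count-∷ Q? x xs | count-∷ R? x xs | count-∷ S? x xs =
  subst₂ _≤_ (+-interchange p q cP cQ) (+-interchange r s cR cS)
    (ℕ.+-mono-≤ (pointwise x) (count-mono₂ P? Q? R? S? xs pointwise))
  where
  p q r s cP cQ cR cS : ℕ
  p = indicator (P? x); q = indicator (Q? x); r = indicator (R? x); s = indicator (S? x)
  cP = count P? xs; cQ = count Q? xs; cR = count R? xs; cS = count S? xs

count-⊎ : ∀ {P Q R : Pred A₁ 0ℓ} (P? : Decidable P) (Q? : Decidable Q) (R? : Decidable R) xs →
  (∀ x → indicator (P? x) ≤ indicator (Q? x) + indicator (R? x)) → count P? xs ≤ count Q? xs + count R? xs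
count-⊎ P? Q? R? xs pointwise =
  subst (_≤ count Q? xs + count R? xs) (trans (cong (count P? xs +_) (count-∅ xs)) (ℕ.+-identityʳ _))
    (count-mono₂ P? ∅? Q? R? xs (λ x → subst (_≤ _) (sym (ℕ.+-identityʳ _)) (pointwise x)))

count-mono : ∀ {P Q : Pred A₁ 0ℓ} (P? : Decidable P) (Q? : Decidable Q) xs →
  (∀ x → indicator (P? x) ≤ indicator (Q? x)) → count P? xs ≤ count Q? xs
count-mono P? Q? xs pointwise =
  subst (count P? xs ≤_) (trans (cong (count Q? xs +_) (count-∅ xs)) (ℕ.+-identityʳ _))
    (count-⊎ P? Q? ∅? xs (λ x → subst (_ ≤_) (sym (ℕ.+-identityʳ _)) (pointwise x)))

count-cong : ∀ {P Q : Pred A₁ 0ℓ} (P? : Decidable P) (Q? : Decidable Q) xs →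
  (∀ {x} → P x → Q x) → (∀ {x} → Q x → P x) → count P? xs ≡ count Q? xs
count-cong P? Q? xs P⇒Q Q⇒P = ℕ.≤-antisym
  (count-mono P? Q? xs (λ x → ℕ.≤-reflexive (indicator-cong P⇒Q Q⇒P (P? x) (Q? x))))
  (count-mono Q? P? xs (λ x → ℕ.≤-reflexive (indicator-cong Q⇒P P⇒Q (Q? x) (P? x))))

count-allFin-suc : ∀ {m} {P : Pred (Fin (suc m)) 0ℓ} (P? : Decidable P) →
  count P? (allFin (suc m)) ≡ indicator (P? fzero) + count (λ x → P? (fsuc x)) (allFin m)
count-allFin-suc {m} P? = trans (count-∷ P? fzero (tabulate fsuc))
  (cong (indicator (P? fzero) +_) (trans (cong (count P?) (sym (map-tabulate (λ x → x) fsuc))) (count-map P? fsuc (allFin m))))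

count-injective≤1 : ∀ m (f : Fin m → ℕ) → (∀ {a b} → f a ≡ f b → a ≡ b) → ∀ c →
  count (λ x → f x ℕ.≟ c) (allFin m) ≤ 1
count-injective≤1 zero f f-inj c = z≤n
count-injective≤1 (suc m) f f-inj c = subst (_≤ 1) (sym (count-allFin-suc (λ x → f x ℕ.≟ c))) (by-cases (f fzero ℕ.≟ c))
  where
  by-cases : (d : Dec (f fzero ≡ c)) → indicator d + count (λ x → f (fsuc x) ℕ.≟ c) (allFin m) ≤ 1
  by-cases (yes f0≡c) = s≤s (ℕ.≤-reflexive (count-none _ (allFin m) (λ x fx≡c → Fin.0≢1+n (f-inj (trans f0≡c (sym fx≡c))))))
  by-cases (no _) = count-injective≤1 m (λ x → f (fsuc x)) (λ e → Fin.suc-injective (f-inj e)) c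

count-toℕ< : ∀ m j → j ≤ m → count (λ (x : Fin m) → toℕ x <? j) (allFin m) ≡ j
count-toℕ< m zero _ = count-none _ (allFin m) (λ x → ℕ.n≮0)
count-toℕ< (suc m) (suc j) (s≤s j≤m) = begin
  count (λ x → toℕ x <? suc j) (allFin (suc m))         ≡⟨ count-allFin-suc {m} (λ x → toℕ x <? suc j) ⟩
  suc (count (λ x → suc (toℕ x) <? suc j) (allFin m))   ≡⟨ cong suc (count-cong _ _ (allFin m) ℕ.≤-pred s≤s) ⟩
  suc (count (λ x → toℕ x <? j) (allFin m))             ≡⟨ cong suc (count-toℕ< m j j≤m) ⟩
  suc j                                                 ∎

module _ {n} (σ : Permutation′ n) where

  private
    row : Fin n → ℕ
    row x = toℕ (σ ⟨$⟩ʳ x)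

    row-injective : ∀ {a b} → row a ≡ row b → a ≡ b
    row-injective {a} {b} e = trans (sym (inverseˡ σ)) (trans (cong (σ ⟨$⟩ˡ_) (Fin.toℕ-injective e)) (inverseˡ σ))

    cols : (j : ℕ) → Decidable (λ (x : Fin n) → toℕ x < j)
    cols j x = toℕ x <? j

    rows : (i : ℕ) → Decidable (λ (x : Fin n) → row x < i)
    rows i x = row x <? i

  countOnes-monoʳ : ∀ i j → countOnes n σ i j ≤ countOnes n σ i (suc j)
  countOnes-monoʳ i j = count-mono (cols j ∩? rows i) (cols (suc j) ∩? rows i) (allFin n)
    (λ x → indicator-mono (λ (x<j , r) → ℕ.m<n⇒m<1+n x<j , r) (cols j x ×-dec rows i x) (cols (suc j) x ×-dec rows i x))

  countOnes-monoˡ : ∀ i j → countOnes n σ i j ≤ countOnes n σ (suc i) j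
  countOnes-monoˡ i j = count-mono (cols j ∩? rows i) (cols j ∩? rows (suc i)) (allFin n)
    (λ x → indicator-mono (λ (c , r<i) → c , ℕ.m<n⇒m<1+n r<i) (cols j x ×-dec rows i x) (cols j x ×-dec rows (suc i) x))

  countOnes-sucʳ : ∀ i j → countOnes n σ i (suc j) ≤ suc (countOnes n σ i j)
  countOnes-sucʳ i j = ℕ.≤-trans
    (count-⊎ (cols (suc j) ∩? rows i) (cols j ∩? rows i) (λ x → toℕ x ℕ.≟ j) (allFin n)
      (λ x → indicator-⊎ (λ (x<1+j , r) → map₁ (_, r) (ℕ.m<1+n⇒m<n∨m≡n x<1+j))
               (cols (suc j) x ×-dec rows i x) (cols j x ×-dec rows i x) (toℕ x ℕ.≟ j)))
    (ℕ.≤-trans (ℕ.+-monoʳ-≤ (countOnes n σ i j) (count-injective≤1 n toℕ Fin.toℕ-injective j))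
               (ℕ.≤-reflexive (ℕ.+-comm _ 1)))

  countOnes-sucˡ : ∀ i j → countOnes n σ (suc i) j ≤ suc (countOnes n σ i j)
  countOnes-sucˡ i j = ℕ.≤-trans
    (count-⊎ (cols j ∩? rows (suc i)) (cols j ∩? rows i) (λ x → row x ℕ.≟ i) (allFin n)
      (λ x → indicator-⊎ (λ (c , r<1+i) → map₁ (c ,_) (ℕ.m<1+n⇒m<n∨m≡n r<1+i))
               (cols j x ×-dec rows (suc i) x) (cols j x ×-dec rows i x) (row x ℕ.≟ i)))
    (ℕ.≤-trans (ℕ.+-monoʳ-≤ (countOnes n σ i j) (count-injective≤1 n row row-injective i))
               (ℕ.≤-reflexive (ℕ.+-comm _ 1)))

  countOnes-supermodular : ∀ i j →
    countOnes n σ i (suc j) + countOnes n σ (suc i) j ≤ countOnes n σ i j + countOnes n σ (suc i) (suc j)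
  countOnes-supermodular i j =
    count-mono₂ (cols (suc j) ∩? rows i) (cols j ∩? rows (suc i)) (cols j ∩? rows i) (cols (suc j) ∩? rows (suc i)) (allFin n)
      (λ x → indicator-supermodular ℕ.m<n⇒m<1+n ℕ.m<n⇒m<1+n (cols j x) (cols (suc j) x) (rows i x) (rows (suc i) x))

  countOnes-zeroʳ : ∀ i → countOnes n σ i 0 ≡ 0
  countOnes-zeroʳ i = count-none (cols 0 ∩? rows i) (allFin n) (λ x (x<0 , _) → ℕ.n≮0 x<0)

  countOnes-zeroˡ : ∀ j → countOnes n σ 0 j ≡ 0
  countOnes-zeroˡ j = count-none (cols j ∩? rows 0) (allFin n) (λ x (_ , r<0) → ℕ.n≮0 r<0)

  countOnes-full : ∀ j → j ≤ n → countOnes n σ n j ≡ j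
  countOnes-full j j≤n = trans (count-cong (cols j ∩? rows n) (cols j) (allFin n) proj₁ (λ {x} x<j → x<j , Fin.toℕ<n _))
                               (count-toℕ< n j j≤n)

-- Adding a cell to a Young diagram

-- κ ⋖[ y ] ρ : ρ is κ with one cell added at the end of row y (rows are 1-indexed, as for part).
data _⋖[_]_ : Partition → ℕ → Partition → Set where
  new-row : [] ⋖[ 1 ] (1 ∷ [])
  here    : ∀ {k ks} → (k ∷ ks) ⋖[ 1 ] (suc k ∷ ks)
  there   : ∀ {k ks y rs} → ks ⋖[ suc y ] rs → (k ∷ ks) ⋖[ suc (suc y) ] (k ∷ rs)

part-0 : ∀ κ → part κ 0 ≡ 0
part-0 [] = refl
part-0 (_ ∷ _) = refl

conj-∷ : ∀ x k ks → conj (k ∷ ks) x ≡ indicator (x ≤? k) + conj ks x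
conj-∷ x = count-∷ (x ≤?_)

private variable
  κ ρ : Partition
  y : ℕ

⋖-row-pos : κ ⋖[ y ] ρ → 1 ≤ y
⋖-row-pos new-row = s≤s z≤n
⋖-row-pos here = s≤s z≤n
⋖-row-pos (there _) = s≤s z≤n

⋖-row≤length : κ ⋖[ y ] ρ → y ≤ length ρ
⋖-row≤length new-row = s≤s z≤n
⋖-row≤length here = s≤s z≤n
⋖-row≤length (there κ⋖ρ) = s≤s (⋖-row≤length κ⋖ρ)

⋖-size : κ ⋖[ y ] ρ → size ρ ≡ suc (size κ)
⋖-size new-row = refl
⋖-size here = refl
⋖-size {κ = k ∷ ks} (there κ⋖ρ) = trans (cong (k +_) (⋖-size κ⋖ρ)) (ℕ.+-suc k (size ks))

⋖⇒≢ : κ ⋖[ y ] ρ → ρ ≢ κ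
⋖⇒≢ κ⋖ρ ρ≡κ = ℕ.1+n≢n (trans (sym (⋖-size κ⋖ρ)) (cong size ρ≡κ))

⋖-part : κ ⋖[ y ] ρ → part ρ y ≡ suc (part κ y)
⋖-part new-row = refl
⋖-part here = refl
⋖-part (there κ⋖ρ) = ⋖-part κ⋖ρ

⋖-part-other : κ ⋖[ y ] ρ → ∀ y′ → y′ ≢ y → part ρ y′ ≡ part κ y′
⋖-part-other new-row zero _ = refl
⋖-part-other new-row (suc zero) y′≢1 = ⊥-elim (y′≢1 refl)
⋖-part-other new-row (suc (suc _)) _ = refl
⋖-part-other here zero _ = refl
⋖-part-other here (suc zero) y′≢1 = ⊥-elim (y′≢1 refl)
⋖-part-other here (suc (suc _)) _ = refl
⋖-part-other (there _) zero _ = refl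
⋖-part-other (there _) (suc zero) _ = refl
⋖-part-other (there κ⋖ρ) (suc (suc y′)) y′≢y = ⋖-part-other κ⋖ρ (suc y′) (λ e → y′≢y (cong suc e))

⋖-⊆ : κ ⋖[ y ] ρ → κ ⊆ₚ ρ
⋖-⊆ {y = y} κ⋖ρ y′ with y′ ℕ.≟ y
... | yes refl = ℕ.≤-trans (ℕ.n≤1+n _) (ℕ.≤-reflexive (sym (⋖-part κ⋖ρ)))
... | no y′≢y = ℕ.≤-reflexive (sym (⋖-part-other κ⋖ρ y′ y′≢y))

⋖-conj : κ ⋖[ y ] ρ → conj ρ (suc (part κ y)) ≡ suc (conj κ (suc (part κ y)))
⋖-conj new-row = refl
⋖-conj {κ = k ∷ ks} here = begin
  conj (suc k ∷ ks) (suc k)                      ≡⟨ conj-∷ (suc k) (suc k) ks ⟩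
  indicator (suc k ≤? suc k) + conj ks (suc k)   ≡⟨ cong (_+ conj ks (suc k)) (indicator-yes ℕ.≤-refl (suc k ≤? suc k)) ⟩
  suc (conj ks (suc k))                          ≡⟨ cong (λ b → suc (b + conj ks (suc k))) (sym (indicator-no (ℕ.n≮n k) (suc k ≤? k))) ⟩
  suc (indicator (suc k ≤? k) + conj ks (suc k)) ≡⟨ cong suc (sym (conj-∷ (suc k) k ks)) ⟩
  suc (conj (k ∷ ks) (suc k))                    ∎
⋖-conj {κ = k ∷ ks} {ρ = .k ∷ rs} (there {y = y} κ⋖ρ) = begin
  conj (k ∷ rs) x                       ≡⟨ conj-∷ x k rs ⟩
  indicator (x ≤? k) + conj rs x        ≡⟨ cong (indicator (x ≤? k) +_) (⋖-conj κ⋖ρ) ⟩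
  indicator (x ≤? k) + suc (conj ks x)  ≡⟨ ℕ.+-suc (indicator (x ≤? k)) (conj ks x) ⟩
  suc (indicator (x ≤? k) + conj ks x)  ≡⟨ cong suc (sym (conj-∷ x k ks)) ⟩
  suc (conj (k ∷ ks) x)                 ∎
  where
  x : ℕ
  x = suc (part ks (suc y))

⋖-conj-other : κ ⋖[ y ] ρ → ∀ x → 1 ≤ x → x ≢ suc (part κ y) → conj ρ x ≡ conj κ x
⋖-conj-other new-row x 1≤x x≢1 = trans (conj-∷ x 1 []) (cong (_+ 0) (indicator-no (λ x≤1 → x≢1 (ℕ.≤-antisym x≤1 1≤x)) (x ≤? 1)))
⋖-conj-other {κ = k ∷ ks} here x 1≤x x≢1+k = begin
  conj (suc k ∷ ks) x                ≡⟨ conj-∷ x (suc k) ks ⟩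
  indicator (x ≤? suc k) + conj ks x ≡⟨ cong (_+ conj ks x) (indicator-cong (λ x≤1+k → ℕ.≤-pred (ℕ.≤∧≢⇒< x≤1+k x≢1+k)) ℕ.m≤n⇒m≤1+n (x ≤? suc k) (x ≤? k)) ⟩
  indicator (x ≤? k) + conj ks x     ≡⟨ sym (conj-∷ x k ks) ⟩
  conj (k ∷ ks) x                    ∎
⋖-conj-other {κ = k ∷ ks} {ρ = .k ∷ rs} (there κ⋖ρ) x 1≤x x≢c = begin
  conj (k ∷ rs) x                 ≡⟨ conj-∷ x k rs ⟩
  indicator (x ≤? k) + conj rs x  ≡⟨ cong (indicator (x ≤? k) +_) (⋖-conj-other κ⋖ρ x 1≤x x≢c) ⟩
  indicator (x ≤? k) + conj ks x  ≡⟨ sym (conj-∷ x k ks) ⟩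
  conj (k ∷ ks) x                 ∎

⋖-injective : ∀ {κ y ρ ρ′} → κ ⋖[ y ] ρ → κ ⋖[ y ] ρ′ → ρ ≡ ρ′
⋖-injective new-row new-row = refl
⋖-injective here here = refl
⋖-injective (there κ⋖ρ) (there κ⋖ρ′) = cong (_ ∷_) (⋖-injective κ⋖ρ κ⋖ρ′)

part-≤-head : ∀ {k ks} → Decreasing (k ∷ ks) → ∀ y → part (k ∷ ks) y ≤ k
part-≤-head _ zero = z≤n
part-≤-head _ (suc zero) = ℕ.≤-refl
part-≤-head dec-[x] (suc (suc y)) = z≤n
part-≤-head (dec-∷ k′≤k d) (suc (suc y)) = ℕ.≤-trans (part-≤-head d (suc y)) k′≤k

Decreasing-tail : ∀ {k ks} → Decreasing (k ∷ ks) → Decreasing ks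
Decreasing-tail dec-[x] = dec-[]
Decreasing-tail (dec-∷ _ d) = d

≤conj⇒≤part : ∀ {κ} → Decreasing κ → ∀ {x y} → 1 ≤ y → y ≤ conj κ x → x ≤ part κ y
≤conj⇒≤part {[]} _ 1≤y y≤0 = ⊥-elim (ℕ.<-irrefl refl (ℕ.≤-trans 1≤y y≤0))
≤conj⇒≤part {k ∷ ks} d {x} {y} 1≤y y≤conj = by-cases (x ≤? k) 1≤y (subst (y ≤_) (conj-∷ x k ks) y≤conj)
  where
  by-cases : (x≤?k : Dec (x ≤ k)) → ∀ {y} → 1 ≤ y → y ≤ indicator x≤?k + conj ks x → x ≤ part (k ∷ ks) y
  by-cases (yes x≤k) {suc zero} _ _ = x≤k
  by-cases (yes _) {suc (suc y′)} _ y≤ = ≤conj⇒≤part (Decreasing-tail d) (s≤s z≤n) (ℕ.≤-pred y≤)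
  by-cases (no x≰k) {suc y′} 1≤y y≤ =
    ⊥-elim (x≰k (ℕ.≤-trans (≤conj⇒≤part (Decreasing-tail d) 1≤y y≤) (part-≤-head d (suc (suc y′)))))

≤part⇒≤conj : ∀ {κ} → Decreasing κ → ∀ {x y} → 1 ≤ x → 1 ≤ y → x ≤ part κ y → y ≤ conj κ x
≤part⇒≤conj {[]} _ 1≤x _ x≤0 = ⊥-elim (ℕ.<-irrefl refl (ℕ.≤-trans 1≤x x≤0))
≤part⇒≤conj {k ∷ ks} d {x} {y} 1≤x 1≤y x≤part = subst (y ≤_) (sym (conj-∷ x k ks)) (by-cases (x ≤? k) 1≤y x≤part)
  where
  by-cases : (x≤?k : Dec (x ≤ k)) → ∀ {y} → 1 ≤ y → x ≤ part (k ∷ ks) y → y ≤ indicator x≤?k + conj ks x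
  by-cases (no x≰k) {y} _ x≤part = ⊥-elim (x≰k (ℕ.≤-trans x≤part (part-≤-head d y)))
  by-cases (yes _) {suc zero} _ _ = s≤s z≤n
  by-cases (yes _) {suc (suc y′)} _ x≤part = s≤s (≤part⇒≤conj (Decreasing-tail d) 1≤x (s≤s z≤n) x≤part)

⋖-row≡ : ∀ {κ ρ y} → Decreasing κ → Decreasing ρ → κ ⋖[ y ] ρ → y ≡ suc (conj κ (suc (part κ y)))
⋖-row≡ {κ} {ρ} {y} dκ dρ κ⋖ρ = ℕ.≤-antisym y≤1+height (ℕ.≰⇒> y≰height)
  where
  y≤1+height : y ≤ suc (conj κ (suc (part κ y)))
  y≤1+height = subst (y ≤_) (⋖-conj κ⋖ρ) (≤part⇒≤conj dρ (s≤s z≤n) (⋖-row-pos κ⋖ρ) (ℕ.≤-reflexive (sym (⋖-part κ⋖ρ))))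
  y≰height : ¬ y ≤ conj κ (suc (part κ y))
  y≰height y≤height = ℕ.<-irrefl refl (≤conj⇒≤part dκ (⋖-row-pos κ⋖ρ) y≤height)

filter-applyUpTo-first : ∀ {P : Pred ℕ 0ℓ} (P? : Decidable P) (f : ℕ → ℕ) {m y} →
  y < m → P (f y) → (∀ {z} → z < y → ¬ P (f z)) → ∃ λ r → filter P? (applyUpTo f m) ≡ f y ∷ r
filter-applyUpTo-first P? f {suc m} {zero} _ p _ = _ , filter-accept P? p
filter-applyUpTo-first P? f {suc m} {suc y} (s≤s y<m) p before
  with filter-applyUpTo-first P? (λ z → f (suc z)) y<m p (λ z<y → before (s≤s z<y))
... | r , eq = r , trans (filter-reject P? (before (s≤s z≤n))) eq

diffRow-∷ : ∀ κ ρ {y r} → filter (λ z → part κ z <? part ρ z) (range1 (length ρ)) ≡ y ∷ r → diffRow κ ρ ≡ y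
diffRow-∷ κ ρ eq rewrite eq = refl

⋖-diffRow : κ ⋖[ y ] ρ → diffRow κ ρ ≡ y
⋖-diffRow {κ} {suc y} {ρ} κ⋖ρ
  with filter-applyUpTo-first (λ z → part κ z <? part ρ z) suc (⋖-row≤length κ⋖ρ)
         (ℕ.≤-reflexive (sym (⋖-part κ⋖ρ)))
         (λ z<y → ℕ.<-irrefl (sym (⋖-part-other κ⋖ρ _ (λ e → ℕ.<-irrefl (ℕ.suc-injective e) z<y))))
... | r , eq = diffRow-∷ κ ρ (trans (cong (filter _) (map-upTo suc (length ρ))) eq)

diffRow-refl : ∀ κ → diffRow κ κ ≡ 0
diffRow-refl κ rewrite filter-none (λ z → part κ z <? part κ z) (All.universal (λ _ → ℕ.<-irrefl refl) (range1 (length κ))) = refl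

⋖-Rcells : κ ⋖[ y ] ρ → Rcells κ ρ ≡ map (λ x → (x , y)) (range1 (part κ y))
⋖-Rcells κ⋖ρ rewrite ⋖-diffRow κ⋖ρ = refl

⋖-Ccells : κ ⋖[ y ] ρ →
  Ccells κ ρ ≡ map (λ z → (suc (part κ y) , z)) (range1 (conj κ (suc (part κ y))))
⋖-Ccells κ⋖ρ rewrite ⋖-diffRow κ⋖ρ | ⋖-part κ⋖ρ = refl

⋖-opposite-row : ∀ {μ ρ λ′ ν ya yb y} → μ ⋖[ ya ] ρ → μ ⋖[ yb ] λ′ → ρ ⋖[ y ] ν → λ′ ⊆ₚ ν → ya ≢ yb → y ≡ yb
⋖-opposite-row {μ} {ρ} {λ′} {ν} {ya} {yb} {y} μ⋖ρ μ⋖λ ρ⋖ν λ⊆ν ya≢yb with y ℕ.≟ yb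
... | yes y≡yb = y≡yb
... | no y≢yb = ⊥-elim (ℕ.1+n≰n (subst₂ _≤_ (⋖-part μ⋖λ)
    (trans (⋖-part-other ρ⋖ν yb (λ e → y≢yb (sym e))) (⋖-part-other μ⋖ρ yb (λ e → ya≢yb (sym e)))) (λ⊆ν yb)))

⋖-distinct-columns : ∀ {μ ρ λ′ ya yb} → Decreasing μ → Decreasing ρ → Decreasing λ′ →
  μ ⋖[ ya ] ρ → μ ⋖[ yb ] λ′ → ya ≢ yb → part μ ya ≢ part μ yb
⋖-distinct-columns {μ} dμ dρ dλ μ⋖ρ μ⋖λ ya≢yb pa≡pb =
  ya≢yb (trans (⋖-row≡ dμ dρ μ⋖ρ) (trans (cong (λ p → suc (conj μ (suc p))) pa≡pb) (sym (⋖-row≡ dμ dλ μ⋖λ))))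

infix 4 _⋖=_
_⋖=_ : Partition → Partition → Set
κ ⋖= ρ = κ ≡ ρ ⊎ ∃ (κ ⋖[_] ρ)

⊆ₚ-tail : ∀ {k ks r rs} → (k ∷ ks) ⊆ₚ (r ∷ rs) → ks ⊆ₚ rs
⊆ₚ-tail {ks = ks} {rs = rs} _ zero = subst (_≤ part rs 0) (sym (part-0 ks)) z≤n
⊆ₚ-tail ⊆ (suc y) = ⊆ (suc (suc y))

size≡0⇒[] : AllPos κ → size κ ≡ 0 → κ ≡ []
size≡0⇒[] pos-[] _ = refl
size≡0⇒[] {k ∷ _} (pos-∷ 0<k _) size≡0 = ⊥-elim (ℕ.n≮0 (subst (0 <_) (ℕ.m+n≡0⇒m≡0 k size≡0) 0<k))

size-mono : AllPos κ → κ ⊆ₚ ρ → size κ ≤ size ρ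
size-mono {[]} _ _ = z≤n
size-mono {_ ∷ _} {[]} (pos-∷ 1≤k _) ⊆ = ⊥-elim (ℕ.1+n≰n (ℕ.≤-trans 1≤k (⊆ 1)))
size-mono {_ ∷ _} {_ ∷ rs} (pos-∷ _ p) ⊆ = ℕ.+-mono-≤ (⊆ 1) (size-mono {ρ = rs} p (⊆ₚ-tail ⊆))

private
  +-≤-≡ : ∀ {a b c d} → a ≤ c → b ≤ d → a + b ≡ c + d → a ≡ c × b ≡ d
  +-≤-≡ {a} {b} {c} {d} a≤c b≤d e with ℕ.m≤n⇒m<n∨m≡n a≤c
  ... | inj₂ refl = refl , ℕ.+-cancelˡ-≡ a b d e
  ... | inj₁ a<c = ⊥-elim (ℕ.<-irrefl e (ℕ.+-mono-<-≤ a<c b≤d))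

⊆ₚ-size-≡ : AllPos κ → AllPos ρ → κ ⊆ₚ ρ → size ρ ≡ size κ → κ ≡ ρ
⊆ₚ-size-≡ {[]} _ pρ _ e = sym (size≡0⇒[] pρ e)
⊆ₚ-size-≡ {_ ∷ _} {[]} (pos-∷ 1≤k _) _ ⊆ _ = ⊥-elim (ℕ.1+n≰n (ℕ.≤-trans 1≤k (⊆ 1)))
⊆ₚ-size-≡ {k ∷ ks} {r ∷ rs} (pos-∷ _ pκ) (pos-∷ _ pρ) ⊆ e
  with +-≤-≡ (⊆ 1) (size-mono {ρ = rs} pκ (⊆ₚ-tail ⊆)) (sym e)
... | refl , e′ = cong (k ∷_) (⊆ₚ-size-≡ pκ pρ (⊆ₚ-tail ⊆) (sym e′))

⊆ₚ-size-suc : AllPos κ → AllPos ρ → κ ⊆ₚ ρ → size ρ ≡ suc (size κ) → ∃ (κ ⋖[_] ρ)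
⊆ₚ-size-suc {[]} {r ∷ rs} _ (pos-∷ 1≤r pρ) _ e with +-≤-≡ {1} {0} 1≤r z≤n (sym e)
... | refl , e′ with size≡0⇒[] pρ (sym e′)
... | refl = 1 , new-row
⊆ₚ-size-suc {_ ∷ _} {[]} (pos-∷ 1≤k _) _ ⊆ _ = ⊥-elim (ℕ.1+n≰n (ℕ.≤-trans 1≤k (⊆ 1)))
⊆ₚ-size-suc {k ∷ ks} {r ∷ rs} (pos-∷ _ pκ) (pos-∷ _ pρ) ⊆ e with ℕ.m≤n⇒m<n∨m≡n (⊆ 1)
... | inj₂ refl = there′ (⊆ₚ-size-suc pκ pρ (⊆ₚ-tail ⊆) (ℕ.+-cancelˡ-≡ k _ _ (trans e (sym (ℕ.+-suc k (size ks))))))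
  where
  there′ : ∃ (ks ⋖[_] rs) → ∃ ((k ∷ ks) ⋖[_] (k ∷ rs))
  there′ (_ , new-row) = _ , there new-row
  there′ (_ , here) = _ , there here
  there′ (_ , there ks⋖rs) = _ , there (there ks⋖rs)
... | inj₁ k<r with +-≤-≡ k<r (size-mono {ρ = rs} pκ (⊆ₚ-tail ⊆)) (sym e)
...   | refl , e′ with ⊆ₚ-size-≡ pκ pρ (⊆ₚ-tail ⊆) (sym e′)
...     | refl = 1 , here

⊆ₚ-⋖= : AllPos κ → AllPos ρ → κ ⊆ₚ ρ → size κ ≤ size ρ → size ρ ≤ suc (size κ) → κ ⋖= ρ
⊆ₚ-⋖= pκ pρ ⊆ |κ|≤|ρ| |ρ|≤1+|κ| with ℕ.m≤n⇒m<n∨m≡n |κ|≤|ρ|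
... | inj₂ e = inj₁ (⊆ₚ-size-≡ pκ pρ ⊆ (sym e))
... | inj₁ |κ|<|ρ| = inj₂ (⊆ₚ-size-suc pκ pρ ⊆ (ℕ.≤-antisym |ρ|≤1+|κ| |κ|<|ρ|))

⋖=-size : κ ⋖= ρ → size ρ ≡ size κ ⊎ size ρ ≡ suc (size κ)
⋖=-size (inj₁ refl) = inj₁ refl
⋖=-size (inj₂ (_ , κ⋖ρ)) = inj₂ (⋖-size κ⋖ρ)

⋖-⋖-¬⋖= : ∀ {κ ρ ν y y′} → κ ⋖[ y ] ρ → ρ ⋖[ y′ ] ν → ¬ κ ⋖= ν
⋖-⋖-¬⋖= {κ} {ρ} {ν} κ⋖ρ ρ⋖ν κ⋖=ν = too-big (⋖=-size κ⋖=ν)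
  where
  |ν|≡2+|κ| : size ν ≡ suc (suc (size κ))
  |ν|≡2+|κ| = trans (⋖-size ρ⋖ν) (cong suc (⋖-size κ⋖ρ))
  too-big : size ν ≡ size κ ⊎ size ν ≡ suc (size κ) → ⊥
  too-big (inj₁ e) = ℕ.<-irrefl (trans (sym e) |ν|≡2+|κ|) (ℕ.m<n⇒m<1+n (ℕ.n<1+n (size κ)))
  too-big (inj₂ e) = ℕ.1+n≢n (trans (sym |ν|≡2+|κ|) e)

module _ (q t : ℚ) where
  open Weights q t

  k : ℚ
  k = (1ℚ - t) ÷ (1ℚ - q)

  -- The exponent is 0 or 1 along the edges of a growth, so φ₁ is φ/k on a one-cell step and 1 on a trivial one.
  φ₁ : Partition → Partition → ℚ
  φ₁ κ ρ = (φ κ ρ * inv k) ^ (size ρ ∸ size κ)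

  bAt-cong : ∀ κ κ′ {x y} → part κ y ≡ part κ′ y → conj κ x ≡ conj κ′ x → bAt κ (x , y) ≡ bAt κ′ (x , y)
  bAt-cong κ κ′ {x} {y} part≡ conj≡ = cong₂ (λ p c → b (p ∸ x) (c ∸ y)) part≡ conj≡

  ψ-refl : ∀ κ → ψ κ κ ≡ 1ℚ
  ψ-refl κ rewrite diffRow-refl κ | part-0 κ = refl

  ψ-⋖ : ∀ {κ ρ y} → κ ⋖[ y ] ρ → ψ κ ρ ≡ prodℚ (map (λ x → bAt κ (x , y) ÷ bAt ρ (x , y)) (range1 (part κ y)))
  ψ-⋖ {κ = κ} {ρ = ρ} {y = y} κ⋖ρ =
    trans (cong (λ cs → prodℚ (map (λ c → bAt κ c ÷ bAt ρ c) cs)) (⋖-Rcells κ⋖ρ)) (cong prodℚ (sym (map-∘ (range1 (part κ y)))))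

  φ-⋖ : ∀ {κ ρ y} → κ ⋖[ y ] ρ → φ κ ρ ≡
    k * prodℚ (map (λ z → bAt ρ (suc (part κ y) , z) ÷ bAt κ (suc (part κ y) , z)) (range1 (conj κ (suc (part κ y)))))
  φ-⋖ {κ = κ} {ρ = ρ} {y = y} κ⋖ρ = cong (k *_)
    (trans (cong (λ cs → prodℚ (map (λ c → bAt ρ c ÷ bAt κ c) cs)) (⋖-Ccells κ⋖ρ)) (cong prodℚ (sym (map-∘ (range1 (conj κ (suc (part κ y))))))))

  ψ-⋖-after : ∀ {μ ρ ν ya yb} → μ ⋖[ ya ] ρ → ρ ⋖[ yb ] ν → yb ≢ ya →
    ψ ρ ν ≡ prodℚ (map (λ x → bAt ρ (x , yb) ÷ bAt ν (x , yb)) (range1 (part μ yb)))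
  ψ-⋖-after {ρ = ρ} {ν} {yb = yb} μ⋖ρ ρ⋖ν yb≢ya =
    trans (ψ-⋖ ρ⋖ν) (cong (λ p → prodℚ (map (λ x → bAt ρ (x , yb) ÷ bAt ν (x , yb)) (range1 p))) (⋖-part-other μ⋖ρ yb yb≢ya))

  φ-⋖-after : ∀ {μ λ′ ν ya yb} → μ ⋖[ yb ] λ′ → λ′ ⋖[ ya ] ν → ya ≢ yb → part μ ya ≢ part μ yb →
    φ λ′ ν ≡ k * prodℚ (map (λ z → bAt ν (suc (part μ ya) , z) ÷ bAt λ′ (suc (part μ ya) , z)) (range1 (conj μ (suc (part μ ya)))))
  φ-⋖-after {μ} {λ′} {ν} {ya} μ⋖λ λ⋖ν ya≢yb pa≢pb = trans (φ-⋖ λ⋖ν) (trans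
    (cong (λ p → k * prodℚ (map (λ z → bAt ν (suc p , z) ÷ bAt λ′ (suc p , z)) (range1 (conj λ′ (suc p))))) (⋖-part-other μ⋖λ ya ya≢yb))
    (cong (λ h → k * prodℚ (map (λ z → bAt ν (suc (part μ ya) , z) ÷ bAt λ′ (suc (part μ ya) , z)) (range1 h)))
          (⋖-conj-other μ⋖λ _ (s≤s z≤n) (λ e → pa≢pb (ℕ.suc-injective e)))))

  bAt-⋖-other : ∀ {κ ρ y x z} → κ ⋖[ y ] ρ → 1 ≤ x → x ≢ suc (part κ y) → z ≢ y → bAt κ (x , z) ≡ bAt ρ (x , z)
  bAt-⋖-other {κ} {ρ} {x = x} {z} κ⋖ρ 1≤x x≢col z≢y =
    bAt-cong κ ρ (sym (⋖-part-other κ⋖ρ z z≢y)) (sym (⋖-conj-other κ⋖ρ x 1≤x x≢col))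

  φ₁-refl : ∀ κ → φ₁ κ κ ≡ 1ℚ
  φ₁-refl κ rewrite ℕ.n∸n≡0 (size κ) = refl

  φ₁-⋖ : ∀ {κ ρ y} → κ ⋖[ y ] ρ → φ₁ κ ρ ≡ φ κ ρ * inv k
  φ₁-⋖ {κ} κ⋖ρ rewrite ⋖-size κ⋖ρ | ℕ.m+n∸n≡m 1 (size κ) = *-identityʳ _

  module _ (generic : Generic q t) where

    br-≢0 : ∀ i j → ¬ (i ≡ 0 × j ≡ 0) → br i j ≢ 0ℚ
    br-≢0 i j ¬i≡j≡0 br≡0 = proj₂ (proj₂ generic) (ℤ.+ i) (ℤ.+ j)
      (λ (i≡0 , j≡0) → ¬i≡j≡0 (ℤ.+-injective i≡0 , ℤ.+-injective j≡0)) (1-x≡0⇒x≡1 br≡0)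

    br-sucʳ-≢0 : ∀ i j → br i (suc j) ≢ 0ℚ
    br-sucʳ-≢0 i j = br-≢0 i (suc j) (λ ())

    br-sucˡ-≢0 : ∀ i j → br (suc i) j ≢ 0ℚ
    br-sucˡ-≢0 i j = br-≢0 (suc i) j (λ ())

    k≢0 : k ≢ 0ℚ
    k≢0 = ÷-≢0 (subst (_≢ 0ℚ) (cong (1ℚ -_) (trans (*-identityˡ _) (*-identityʳ t))) (br-sucʳ-≢0 0 0))
               (subst (_≢ 0ℚ) (cong (1ℚ -_) (trans (*-identityʳ _) (*-identityʳ q))) (br-sucˡ-≢0 0 0))

    bAt-≢0 : ∀ κ c → bAt κ c ≢ 0ℚ
    bAt-≢0 κ c = ÷-≢0 (br-sucʳ-≢0 (arm κ c) (leg κ c)) (br-sucˡ-≢0 (arm κ c) (leg κ c))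

    -- α, ᾱ and b are built from the two brackets [a, l+1] and [a+1, l] of a cell; b = [a, l+1] / [a+1, l].
    private
      A B : Partition → Cell → ℚ
      A κ c = br (arm κ c) (suc (leg κ c))
      B κ c = br (suc (arm κ c)) (leg κ c)

      A-≢0 : ∀ κ c → A κ c ≢ 0ℚ
      A-≢0 κ c = br-sucʳ-≢0 (arm κ c) (leg κ c)

      B-≢0 : ∀ κ c → B κ c ≢ 0ℚ
      B-≢0 κ c = br-sucˡ-≢0 (arm κ c) (leg κ c)

      ratio-≢0 : ∀ (X : Partition → Cell → ℚ) → (∀ κ c → X κ c ≢ 0ℚ) → ∀ κ ρ cs →
        prodℚ (map (λ c → X κ c ÷ X ρ c) cs) ≢ 0ℚ
      ratio-≢0 X X≢0 κ ρ cs = prodℚ-map-≢0 _ cs (λ c → ÷-≢0 (X≢0 κ c) (X≢0 ρ c))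

    α-≢0 : ∀ κ ρ → α κ ρ ≢ 0ℚ
    α-≢0 κ ρ = *-≢0 (ratio-≢0 A A-≢0 κ ρ (Rcells κ ρ)) (ratio-≢0 B B-≢0 κ ρ (Ccells κ ρ))

    ᾱ-≢0 : ∀ κ ρ → ᾱ κ ρ ≢ 0ℚ
    ᾱ-≢0 κ ρ = *-≢0 (ratio-≢0 B B-≢0 κ ρ (Rcells κ ρ)) (ratio-≢0 A A-≢0 κ ρ (Ccells κ ρ))

    ψ-≢0 : ∀ κ ρ → ψ κ ρ ≢ 0ℚ
    ψ-≢0 κ ρ = ratio-≢0 bAt bAt-≢0 κ ρ (Rcells κ ρ)

    φ-≢0 : ∀ κ ρ → φ κ ρ ≢ 0ℚ
    φ-≢0 κ ρ = *-≢0 k≢0 (ratio-≢0 bAt bAt-≢0 ρ κ (Ccells κ ρ))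

    k*α≡ᾱ*ψ*φ : ∀ κ ρ → k * α κ ρ ≡ ᾱ κ ρ * ψ κ ρ * φ κ ρ
    k*α≡ᾱ*ψ*φ κ ρ = begin
      k * (∏R A * ∏C B)                    ≡⟨ cong₂ (λ u v → k * (u * v)) row-factors column-factors ⟩
      k * ((∏R B * ψ κ ρ) * (∏C A * ∏C′))  ≡⟨ solve 5 (λ k a b c d → k :* ((a :* b) :* (c :* d)) := ((a :* c) :* b) :* (k :* d)) refl k (∏R B) (ψ κ ρ) (∏C A) ∏C′ ⟩
      (∏R B * ∏C A) * ψ κ ρ * φ κ ρ        ∎
      where
      ∏R ∏C : (Partition → Cell → ℚ) → ℚ
      ∏R X = prodℚ (map (λ c → X κ c ÷ X ρ c) (Rcells κ ρ))
      ∏C X = prodℚ (map (λ c → X κ c ÷ X ρ c) (Ccells κ ρ))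
      ∏C′ : ℚ
      ∏C′ = prodℚ (map (λ c → bAt ρ c ÷ bAt κ c) (Ccells κ ρ))
      row-factors : ∏R A ≡ ∏R B * ψ κ ρ
      row-factors = trans (prodℚ-map-cong (Rcells κ ρ) (λ c → ÷-split (A κ c) (A ρ c) (B-≢0 κ c) (B-≢0 ρ c)))
                          (prodℚ-map-* _ _ (Rcells κ ρ))
      column-factors : ∏C B ≡ ∏C A * ∏C′
      column-factors = trans (prodℚ-map-cong (Ccells κ ρ) (λ c →
          trans (÷-split (B κ c) (B ρ c) (A-≢0 κ c) (A-≢0 ρ c)) (cong (A κ c ÷ A ρ c *_) (÷-flip (B κ c) (A κ c) (B ρ c) (A ρ c)))))
        (prodℚ-map-* _ _ (Ccells κ ρ))

    ψ*φ/k≡α/ᾱ : ∀ κ ρ → ψ κ ρ * (φ κ ρ * inv k) ≡ α κ ρ * inv (ᾱ κ ρ)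
    ψ*φ/k≡α/ᾱ κ ρ = begin
      ψ κ ρ * (φ κ ρ * inv k)                    ≡⟨ sym (*-assoc (ψ κ ρ) (φ κ ρ) (inv k)) ⟩
      (ψ κ ρ * φ κ ρ) * inv k                    ≡⟨ cong (_* inv k) (sym (*-cancelʳ-≡ (inv (ᾱ κ ρ) * (k * α κ ρ)) (ψ κ ρ * φ κ ρ) (ᾱ-≢0 κ ρ) ᾱ-cancels)) ⟩
      (inv (ᾱ κ ρ) * (k * α κ ρ)) * inv k        ≡⟨ solve 4 (λ iā k a ik → (iā :* (k :* a)) :* ik := (a :* iā) :* (k :* ik)) refl (inv (ᾱ κ ρ)) k (α κ ρ) (inv k) ⟩
      (α κ ρ * inv (ᾱ κ ρ)) * (k * inv k)        ≡⟨ cong ((α κ ρ * inv (ᾱ κ ρ)) *_) (inv-inverseʳ k≢0) ⟩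
      (α κ ρ * inv (ᾱ κ ρ)) * 1ℚ                 ≡⟨ *-identityʳ _ ⟩
      α κ ρ * inv (ᾱ κ ρ)                        ∎
      where
      ᾱ-cancels : (inv (ᾱ κ ρ) * (k * α κ ρ)) * ᾱ κ ρ ≡ (ψ κ ρ * φ κ ρ) * ᾱ κ ρ
      ᾱ-cancels = begin
        (inv (ᾱ κ ρ) * (k * α κ ρ)) * ᾱ κ ρ  ≡⟨ *-swapʳ (inv (ᾱ κ ρ)) (k * α κ ρ) (ᾱ κ ρ) ⟩
        (inv (ᾱ κ ρ) * ᾱ κ ρ) * (k * α κ ρ)  ≡⟨ cong (_* (k * α κ ρ)) (inv-inverseˡ (ᾱ-≢0 κ ρ)) ⟩
        1ℚ * (k * α κ ρ)                     ≡⟨ *-identityˡ _ ⟩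
        k * α κ ρ                            ≡⟨ k*α≡ᾱ*ψ*φ κ ρ ⟩
        ᾱ κ ρ * ψ κ ρ * φ κ ρ                ≡⟨ solve 3 (λ a p f → a :* p :* f := (p :* f) :* a) refl (ᾱ κ ρ) (ψ κ ρ) (φ κ ρ) ⟩
        (ψ κ ρ * φ κ ρ) * ᾱ κ ρ              ∎

    -- The factors of ψ along row yb and of φ along column xa agree on both sides except at the crossing cell (xa , yb).
    ψ*φ-commute : ∀ {μ ρ λ′ ν ya yb} → Decreasing μ → Decreasing ρ → Decreasing λ′ →
      μ ⋖[ ya ] ρ → μ ⋖[ yb ] λ′ → ρ ⋖[ yb ] ν → λ′ ⋖[ ya ] ν → ya ≢ yb →
      ψ μ λ′ * φ μ ρ ≡ ψ ρ ν * φ λ′ ν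
    ψ*φ-commute {μ} {ρ} {λ′} {ν} {ya} {yb} dμ dρ dλ μ⋖ρ μ⋖λ ρ⋖ν λ⋖ν ya≢yb = begin
      ψ μ λ′ * φ μ ρ    ≡⟨ cong₂ _*_ (ψ-⋖ μ⋖λ) (φ-⋖ μ⋖ρ) ⟩
      P₁ * (k * Q₁)     ≡⟨ *-swapˡ P₁ k Q₁ ⟩
      k * (P₁ * Q₁)     ≡⟨ cong (k *_) (prodℚ-crossing pb h F F′ G G′ (s≤s z≤n) (⋖-row-pos μ⋖λ)
                             (≤part⇒≤conj dμ (s≤s z≤n) (⋖-row-pos μ⋖λ)) (≤conj⇒≤part dμ (⋖-row-pos μ⋖λ))
                             F≗F′ G≗G′ (*-≢0 (÷-≢0 (bAt-≢0 ρ c) (bAt-≢0 ν c)) (÷-≢0 (bAt-≢0 ν c) (bAt-≢0 λ′ c))) crossing) ⟩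
      k * (P₂ * Q₂)     ≡⟨ sym (*-swapˡ P₂ k Q₂) ⟩
      P₂ * (k * Q₂)     ≡⟨ sym (cong₂ _*_ (ψ-⋖-after μ⋖ρ ρ⋖ν yb≢ya) (φ-⋖-after μ⋖λ λ⋖ν ya≢yb pa≢pb)) ⟩
      ψ ρ ν * φ λ′ ν    ∎
      where
      pb xa h : ℕ
      pb = part μ yb
      xa = suc (part μ ya)
      h = conj μ xa
      c : Cell
      c = (xa , yb)
      yb≢ya : yb ≢ ya
      yb≢ya e = ya≢yb (sym e)
      pa≢pb : part μ ya ≢ pb
      pa≢pb = ⋖-distinct-columns dμ dρ dλ μ⋖ρ μ⋖λ ya≢yb
      F F′ G G′ : ℕ → ℚ
      F x = bAt μ (x , yb) ÷ bAt λ′ (x , yb)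
      F′ x = bAt ρ (x , yb) ÷ bAt ν (x , yb)
      G z = bAt ρ (xa , z) ÷ bAt μ (xa , z)
      G′ z = bAt ν (xa , z) ÷ bAt λ′ (xa , z)
      P₁ P₂ Q₁ Q₂ : ℚ
      P₁ = prodℚ (map F (range1 pb))
      P₂ = prodℚ (map F′ (range1 pb))
      Q₁ = prodℚ (map G (range1 h))
      Q₂ = prodℚ (map G′ (range1 h))
      F≗F′ : ∀ x → 1 ≤ x → x ≢ xa → F x ≡ F′ x
      F≗F′ x 1≤x x≢xa = cong₂ _÷_ (bAt-⋖-other μ⋖ρ 1≤x x≢xa yb≢ya)
        (bAt-⋖-other λ⋖ν 1≤x (subst (λ p → x ≢ suc p) (sym (⋖-part-other μ⋖λ ya ya≢yb)) x≢xa) yb≢ya)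
      G≗G′ : ∀ z → 1 ≤ z → z ≢ yb → G z ≡ G′ z
      G≗G′ z _ z≢yb = cong₂ _÷_
        (bAt-⋖-other ρ⋖ν (s≤s z≤n) (subst (λ p → xa ≢ suc p) (sym (⋖-part-other μ⋖ρ yb yb≢ya)) (λ e → pa≢pb (ℕ.suc-injective e))) z≢yb)
        (bAt-⋖-other μ⋖λ (s≤s z≤n) (λ e → pa≢pb (ℕ.suc-injective e)) z≢yb)
      crossing : F xa * G yb ≡ F′ xa * G′ yb
      crossing = begin
        F xa * G yb            ≡⟨ *-comm (F xa) (G yb) ⟩
        G yb * F xa            ≡⟨ ÷-telescope (bAt ρ c) (bAt λ′ c) (bAt-≢0 μ c) ⟩
        bAt ρ c ÷ bAt λ′ c     ≡⟨ sym (÷-telescope (bAt ρ c) (bAt λ′ c) (bAt-≢0 ν c)) ⟩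
        F′ xa * G′ yb          ∎

    φ₁-≢0 : ∀ κ ρ → φ₁ κ ρ ≢ 0ℚ
    φ₁-≢0 κ ρ = ^-≢0 (size ρ ∸ size κ) (*-≢0 (φ-≢0 κ ρ) (inv-≢0 k≢0))

    Psq≡P̄sq-inactive : ∀ μ ρ λ′ ν → ¬ (ρ ≡ λ′ × ν ≢ λ′) → Psq μ ρ λ′ ν ≡ P̄sq μ ρ λ′ ν
    Psq≡P̄sq-inactive μ ρ λ′ ν ¬active with ρ ≟ₚ λ′ | ν ≟ₚ λ′
    ... | yes ρ≡λ | no ν≢λ = ⊥-elim (¬active (ρ≡λ , ν≢λ))
    ... | yes _ | yes _ = refl
    ... | no _ | _ = refl

    Psq-active : ∀ μ λ′ ν → ν ≢ λ′ → Psq μ λ′ λ′ ν ≡ Pλ λ′ μ ν × P̄sq μ λ′ λ′ ν ≡ P̄λ λ′ μ ν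
    Psq-active μ λ′ ν ν≢λ with λ′ ≟ₚ λ′ | ν ≟ₚ λ′
    ... | yes _ | no _ = refl , refl
    ... | yes _ | yes ν≡λ = ⊥-elim (ν≢λ ν≡λ)
    ... | no λ≢λ | _ = ⊥-elim (λ≢λ refl)

    Pλ-refl : ∀ λ′ ν → Pλ λ′ λ′ ν ≡ (t ^ℤ nskew ν λ′) * α λ′ ν × P̄λ λ′ λ′ ν ≡ (t ^ℤ nskew ν λ′) * ᾱ λ′ ν
    Pλ-refl λ′ ν with λ′ ≟ₚ λ′
    ... | yes _ = refl , refl
    ... | no λ≢λ = ⊥-elim (λ≢λ refl)

    Pλ-≢ : ∀ λ′ μ ν → μ ≢ λ′ →
        Pλ λ′ μ ν ≡ ((t ^ℤ (Nval ν λ′ μ ℤ.- ℤ.+ 1)) * α λ′ ν * inv (α μ λ′)) * inv (γ ν λ′ μ)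
      × P̄λ λ′ μ ν ≡ ((t ^ℤ (Nval ν λ′ μ ℤ.- ℤ.+ 1)) * ᾱ λ′ ν * inv (ᾱ μ λ′)) * inv (γ ν λ′ μ)
    Pλ-≢ λ′ μ ν μ≢λ with μ ≟ₚ λ′
    ... | yes μ≡λ = ⊥-elim (μ≢λ μ≡λ)
    ... | no _ = refl , refl

    square-new-cell : ∀ {λ′ ν y} → λ′ ⋖[ y ] ν →
      Psq λ′ λ′ λ′ ν * (ψ λ′ λ′ * φ₁ λ′ λ′) ≡ P̄sq λ′ λ′ λ′ ν * (ψ λ′ ν * φ₁ λ′ ν)
    square-new-cell {λ′} {ν} λ⋖ν
      rewrite proj₁ (Psq-active λ′ λ′ ν (⋖⇒≢ λ⋖ν)) | proj₂ (Psq-active λ′ λ′ ν (⋖⇒≢ λ⋖ν))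
            | proj₁ (Pλ-refl λ′ ν) | proj₂ (Pλ-refl λ′ ν) | ψ-refl λ′ | φ₁-refl λ′ | φ₁-⋖ λ⋖ν = begin
      (T * α λ′ ν) * (1ℚ * 1ℚ)                       ≡⟨ *-identityʳ _ ⟩
      T * α λ′ ν                                     ≡⟨ cong (T *_) (sym (*-÷-cancel (α λ′ ν) (ᾱ-≢0 λ′ ν))) ⟩
      T * (ᾱ λ′ ν * (α λ′ ν * inv (ᾱ λ′ ν)))         ≡⟨ sym (*-assoc T _ _) ⟩
      (T * ᾱ λ′ ν) * (α λ′ ν * inv (ᾱ λ′ ν))         ≡⟨ cong ((T * ᾱ λ′ ν) *_) (sym (ψ*φ/k≡α/ᾱ λ′ ν)) ⟩
      (T * ᾱ λ′ ν) * (ψ λ′ ν * (φ λ′ ν * inv k))     ∎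
      where
      T : ℚ
      T = t ^ℤ nskew ν λ′

    square-merge : ∀ {μ λ′ ν ya y} → μ ⋖[ ya ] λ′ → λ′ ⋖[ y ] ν →
      Psq μ λ′ λ′ ν * (ψ μ λ′ * φ₁ μ λ′) ≡ P̄sq μ λ′ λ′ ν * (ψ λ′ ν * φ₁ λ′ ν)
    square-merge {μ} {λ′} {ν} μ⋖λ λ⋖ν = begin
      Psq μ λ′ λ′ ν * (ψ μ λ′ * φ₁ μ λ′)          ≡⟨ cong₂ _*_ (trans (proj₁ active) (proj₁ weights)) (cong (ψ μ λ′ *_) (φ₁-⋖ μ⋖λ)) ⟩
      ((T * αν * inv αμ) * G) * (ψ μ λ′ * (φ μ λ′ * inv k))   ≡⟨ cong (((T * αν * inv αμ) * G) *_) (ψ*φ/k≡α/ᾱ μ λ′) ⟩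
      ((T * αν * inv αμ) * G) * (αμ * inv ᾱμ)     ≡⟨ solve 6 (λ T αν αμ G iαμ iᾱμ → ((T :* αν :* iαμ) :* G) :* (αμ :* iᾱμ) := (T :* αν :* G :* iᾱμ) :* (iαμ :* αμ)) refl T αν αμ G (inv αμ) (inv ᾱμ) ⟩
      (T * αν * G * inv ᾱμ) * (inv αμ * αμ)       ≡⟨ cong ((T * αν * G * inv ᾱμ) *_) (trans (inv-inverseˡ (α-≢0 μ λ′)) (sym (inv-inverseʳ (ᾱ-≢0 λ′ ν)))) ⟩
      (T * αν * G * inv ᾱμ) * (ᾱν * inv ᾱν)       ≡⟨ solve 6 (λ T αν ᾱν G iᾱν iᾱμ → (T :* αν :* G :* iᾱμ) :* (ᾱν :* iᾱν) := ((T :* ᾱν :* iᾱμ) :* G) :* (αν :* iᾱν)) refl T αν ᾱν G (inv ᾱν) (inv ᾱμ) ⟩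
      ((T * ᾱν * inv ᾱμ) * G) * (αν * inv ᾱν)     ≡⟨ cong (((T * ᾱν * inv ᾱμ) * G) *_) (sym (ψ*φ/k≡α/ᾱ λ′ ν)) ⟩
      ((T * ᾱν * inv ᾱμ) * G) * (ψ λ′ ν * (φ λ′ ν * inv k))   ≡⟨ sym (cong₂ _*_ (trans (proj₂ active) (proj₂ weights)) (cong (ψ λ′ ν *_) (φ₁-⋖ λ⋖ν))) ⟩
      P̄sq μ λ′ λ′ ν * (ψ λ′ ν * φ₁ λ′ ν)          ∎
      where
      T G αν ᾱν αμ ᾱμ : ℚ
      T = t ^ℤ (Nval ν λ′ μ ℤ.- ℤ.+ 1)
      G = inv (γ ν λ′ μ)
      αν = α λ′ ν
      ᾱν = ᾱ λ′ ν
      αμ = α μ λ′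
      ᾱμ = ᾱ μ λ′
      active : Psq μ λ′ λ′ ν ≡ Pλ λ′ μ ν × P̄sq μ λ′ λ′ ν ≡ P̄λ λ′ μ ν
      active = Psq-active μ λ′ ν (⋖⇒≢ λ⋖ν)
      weights : Pλ λ′ μ ν ≡ ((T * αν * inv αμ) * G) × P̄λ λ′ μ ν ≡ ((T * ᾱν * inv ᾱμ) * G)
      weights = Pλ-≢ λ′ μ ν (λ μ≡λ → ⋖⇒≢ μ⋖λ (sym μ≡λ))

    square-two-cells : ∀ {μ ρ λ′ ν ya yb} → Decreasing μ → Decreasing ρ → Decreasing λ′ →
      μ ⋖[ ya ] ρ → μ ⋖[ yb ] λ′ → λ′ ⋖= ν → ρ ⋖= ν → size ρ + size λ′ ≤ size μ + size ν → Dec (ρ ≡ λ′) →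
      Psq μ ρ λ′ ν * (ψ μ λ′ * φ₁ μ ρ) ≡ P̄sq μ ρ λ′ ν * (ψ ρ ν * φ₁ λ′ ν)
    square-two-cells {μ} {ρ} _ _ _ μ⋖ρ _ _ (inj₁ refl) supermodular (yes refl) =
      ⊥-elim (ℕ.1+n≰n (ℕ.≤-trans (ℕ.≤-reflexive (sym (⋖-size μ⋖ρ))) (ℕ.+-cancelʳ-≤ (size ρ) (size ρ) (size μ) supermodular)))
    square-two-cells _ _ _ μ⋖ρ _ _ (inj₂ (_ , ρ⋖ν)) _ (yes refl) = square-merge μ⋖ρ ρ⋖ν
    square-two-cells _ _ _ _ _ (inj₁ refl) (inj₁ refl) _ (no ρ≢λ) = ⊥-elim (ρ≢λ refl)
    square-two-cells _ _ _ μ⋖ρ μ⋖λ (inj₁ refl) (inj₂ (_ , ρ⋖ν)) _ (no _) = ⊥-elim (⋖-⋖-¬⋖= μ⋖ρ ρ⋖ν (inj₂ (_ , μ⋖λ)))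
    square-two-cells _ _ _ μ⋖ρ μ⋖λ (inj₂ (_ , λ⋖ν)) (inj₁ refl) _ (no _) = ⊥-elim (⋖-⋖-¬⋖= μ⋖λ λ⋖ν (inj₂ (_ , μ⋖ρ)))
    square-two-cells {μ} {ρ} {λ′} {ν} {ya} {yb} dμ dρ dλ μ⋖ρ μ⋖λ (inj₂ (_ , λ⋖ν)) (inj₂ (_ , ρ⋖ν)) _ (no ρ≢λ) = cong₂ _*_
      (Psq≡P̄sq-inactive μ ρ λ′ ν (λ (ρ≡λ , _) → ρ≢λ ρ≡λ))
      (begin
        ψ μ λ′ * φ₁ μ ρ                ≡⟨ cong (ψ μ λ′ *_) (φ₁-⋖ μ⋖ρ) ⟩
        ψ μ λ′ * (φ μ ρ * inv k)       ≡⟨ sym (*-assoc (ψ μ λ′) (φ μ ρ) (inv k)) ⟩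
        (ψ μ λ′ * φ μ ρ) * inv k       ≡⟨ cong (_* inv k) (ψ*φ-commute dμ dρ dλ μ⋖ρ μ⋖λ ρ⋖ν′ λ⋖ν′ ya≢yb) ⟩
        (ψ ρ ν * φ λ′ ν) * inv k       ≡⟨ *-assoc (ψ ρ ν) (φ λ′ ν) (inv k) ⟩
        ψ ρ ν * (φ λ′ ν * inv k)       ≡⟨ cong (ψ ρ ν *_) (sym (φ₁-⋖ λ⋖ν)) ⟩
        ψ ρ ν * φ₁ λ′ ν                ∎)
      where
      ya≢yb : ya ≢ yb
      ya≢yb refl = ρ≢λ (⋖-injective μ⋖ρ μ⋖λ)
      ρ⋖ν′ : ρ ⋖[ yb ] ν
      ρ⋖ν′ = subst (ρ ⋖[_] ν) (⋖-opposite-row μ⋖ρ μ⋖λ ρ⋖ν (⋖-⊆ λ⋖ν) ya≢yb) ρ⋖ν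
      λ⋖ν′ : λ′ ⋖[ ya ] ν
      λ⋖ν′ = subst (λ′ ⋖[_] ν) (⋖-opposite-row μ⋖λ μ⋖ρ λ⋖ν (⋖-⊆ ρ⋖ν) (λ e → ya≢yb (sym e))) λ⋖ν

    square-identity : ∀ {μ ρ λ′ ν} → Decreasing μ → Decreasing ρ → Decreasing λ′ →
      μ ⋖= ρ → λ′ ⋖= ν → μ ⋖= λ′ → ρ ⋖= ν → size ρ + size λ′ ≤ size μ + size ν →
      Psq μ ρ λ′ ν * (ψ μ λ′ * φ₁ μ ρ) ≡ P̄sq μ ρ λ′ ν * (ψ ρ ν * φ₁ λ′ ν)
    square-identity {μ} _ _ _ (inj₁ refl) (inj₁ refl) (inj₁ refl) _ _ =
      cong (_* (ψ μ μ * φ₁ μ μ)) (Psq≡P̄sq-inactive μ μ μ μ (λ (_ , μ≢μ) → μ≢μ refl))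
    square-identity _ _ _ (inj₁ refl) (inj₂ (_ , λ⋖ν)) (inj₁ refl) _ _ = square-new-cell λ⋖ν
    square-identity {μ} {λ′ = λ′} _ _ _ (inj₁ refl) (inj₁ refl) (inj₂ (_ , μ⋖λ)) _ _ =
      cong₂ _*_ (Psq≡P̄sq-inactive μ μ λ′ λ′ (λ (μ≡λ , _) → ⋖⇒≢ μ⋖λ (sym μ≡λ)))
                (cong (ψ μ λ′ *_) (trans (φ₁-refl μ) (sym (φ₁-refl λ′))))
    square-identity _ _ _ (inj₁ refl) (inj₂ (_ , λ⋖ν)) (inj₂ (_ , μ⋖λ)) μ⋖=ν _ = ⊥-elim (⋖-⋖-¬⋖= μ⋖λ λ⋖ν μ⋖=ν)
    square-identity {μ} {ρ} _ _ _ (inj₂ (_ , μ⋖ρ)) _ (inj₁ refl) (inj₁ refl) _ =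
      cong₂ _*_ (Psq≡P̄sq-inactive μ ρ μ ρ (λ (ρ≡μ , _) → ⋖⇒≢ μ⋖ρ ρ≡μ))
                (cong (_* φ₁ μ ρ) (trans (ψ-refl μ) (sym (ψ-refl ρ))))
    square-identity _ _ _ (inj₂ (_ , μ⋖ρ)) μ⋖=ν (inj₁ refl) (inj₂ (_ , ρ⋖ν)) _ = ⊥-elim (⋖-⋖-¬⋖= μ⋖ρ ρ⋖ν μ⋖=ν)
    square-identity {ρ = ρ} {λ′} dμ dρ dλ (inj₂ (_ , μ⋖ρ)) λ⋖=ν (inj₂ (_ , μ⋖λ)) ρ⋖=ν supermodular =
      square-two-cells dμ dρ dλ μ⋖ρ μ⋖λ λ⋖=ν ρ⋖=ν supermodular (ρ ≟ₚ λ′)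

module _ {n} {σ : Permutation′ n} {Λ : ℕ → ℕ → Partition} (growth : IsGrowth n σ Λ) where

  private
    partitions : ∀ i j → i ≤ n → j ≤ n → IsPartition (Λ i j)
    partitions = proj₁ growth
    ⊆-right : ∀ i j → i ≤ n → j < n → Λ i j ⊆ₚ Λ i (suc j)
    ⊆-right = proj₁ (proj₂ growth)
    ⊆-down : ∀ i j → i < n → j ≤ n → Λ i j ⊆ₚ Λ (suc i) j
    ⊆-down = proj₁ (proj₂ (proj₂ growth))
    sizes : ∀ i j → i ≤ n → j ≤ n → size (Λ i j) ≡ countOnes n σ i j
    sizes = proj₂ (proj₂ (proj₂ growth))

  Λ-decreasing : ∀ {i j} → i ≤ n → j ≤ n → Decreasing (Λ i j)
  Λ-decreasing i≤n j≤n = proj₁ (partitions _ _ i≤n j≤n)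

  Λ-allPos : ∀ {i j} → i ≤ n → j ≤ n → AllPos (Λ i j)
  Λ-allPos i≤n j≤n = proj₂ (partitions _ _ i≤n j≤n)

  Λ-stepʳ : ∀ {i j} → i ≤ n → j < n → Λ i j ⋖= Λ i (suc j)
  Λ-stepʳ {i} {j} i≤n j<n = ⊆ₚ-⋖= (Λ-allPos i≤n (ℕ.<⇒≤ j<n)) (Λ-allPos i≤n j<n) (⊆-right i j i≤n j<n)
    (subst₂ _≤_ (sym (sizes i j i≤n (ℕ.<⇒≤ j<n))) (sym (sizes i (suc j) i≤n j<n)) (countOnes-monoʳ σ i j))
    (subst₂ (λ a b → a ≤ suc b) (sym (sizes i (suc j) i≤n j<n)) (sym (sizes i j i≤n (ℕ.<⇒≤ j<n))) (countOnes-sucʳ σ i j))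

  Λ-stepˡ : ∀ {i j} → i < n → j ≤ n → Λ i j ⋖= Λ (suc i) j
  Λ-stepˡ {i} {j} i<n j≤n = ⊆ₚ-⋖= (Λ-allPos (ℕ.<⇒≤ i<n) j≤n) (Λ-allPos i<n j≤n) (⊆-down i j i<n j≤n)
    (subst₂ _≤_ (sym (sizes i j (ℕ.<⇒≤ i<n) j≤n)) (sym (sizes (suc i) j i<n j≤n)) (countOnes-monoˡ σ i j))
    (subst₂ (λ a b → a ≤ suc b) (sym (sizes (suc i) j i<n j≤n)) (sym (sizes i j (ℕ.<⇒≤ i<n) j≤n)) (countOnes-sucˡ σ i j))

  Λ-supermodular : ∀ {i j} → i < n → j < n →
    size (Λ i (suc j)) + size (Λ (suc i) j) ≤ size (Λ i j) + size (Λ (suc i) (suc j))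
  Λ-supermodular {i} {j} i<n j<n = subst₂ _≤_
    (sym (cong₂ _+_ (sizes i (suc j) (ℕ.<⇒≤ i<n) j<n) (sizes (suc i) j i<n (ℕ.<⇒≤ j<n))))
    (sym (cong₂ _+_ (sizes i j (ℕ.<⇒≤ i<n) (ℕ.<⇒≤ j<n)) (sizes (suc i) (suc j) i<n j<n)))
    (countOnes-supermodular σ i j)

  Λ-left : ∀ {i} → i ≤ n → Λ i 0 ≡ []
  Λ-left {i} i≤n = size≡0⇒[] (Λ-allPos i≤n z≤n) (trans (sizes i 0 i≤n z≤n) (countOnes-zeroʳ σ i))

  Λ-top : ∀ {j} → j ≤ n → Λ 0 j ≡ []
  Λ-top {j} j≤n = size≡0⇒[] (Λ-allPos z≤n j≤n) (trans (sizes 0 j z≤n j≤n) (countOnes-zeroˡ σ j))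

  Λ-bottom-size : ∀ {j} → j ≤ n → size (Λ n j) ≡ j
  Λ-bottom-size {j} j≤n = trans (sizes n j ℕ.≤-refl j≤n) (countOnes-full σ j j≤n)

  module _ (q t : ℚ) (generic : Generic q t) where
    open Weights q t

    private
      S S̄ X Y : ℕ → ℕ → ℚ
      S i j = Psq (Λ i j) (Λ i (suc j)) (Λ (suc i) j) (Λ (suc i) (suc j))
      S̄ i j = P̄sq (Λ i j) (Λ i (suc j)) (Λ (suc i) j) (Λ (suc i) (suc j))
      X i j = ψ (Λ i j) (Λ (suc i) j)
      Y i j = φ₁ q t (Λ i j) (Λ i (suc j))

    growth-square : ∀ i j → i < n → j < n → S i j * (X i j * Y i j) ≡ S̄ i j * (X i (suc j) * Y (suc i) j)
    growth-square i j i<n j<n = square-identity q t generic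
      (Λ-decreasing i≤n j≤n) (Λ-decreasing i≤n j<n) (Λ-decreasing i<n j≤n)
      (Λ-stepʳ i≤n j<n) (Λ-stepʳ i<n j<n) (Λ-stepˡ i<n j≤n) (Λ-stepˡ i<n j<n) (Λ-supermodular i<n j<n)
      where
      i≤n : i ≤ n
      i≤n = ℕ.<⇒≤ i<n
      j≤n : j ≤ n
      j≤n = ℕ.<⇒≤ j<n

    growth-telescope : grid n S ≡ grid n S̄ * (∏< n (λ i → X i n) * ∏< n (λ j → Y n j))
    growth-telescope = grid-telescope n S S̄ X Y
      (λ i j → ψ-≢0 q t generic (Λ i j) (Λ (suc i) j)) (λ i j → φ₁-≢0 q t generic (Λ i j) (Λ i (suc j)))
      (λ i i<n → cong₂ ψ (Λ-left (ℕ.<⇒≤ i<n)) (Λ-left i<n))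
      (λ j j<n → cong₂ (φ₁ q t) (Λ-top (ℕ.<⇒≤ j<n)) (Λ-top j<n))
      growth-square

    bottom-row : ∏< n (λ j → Y n j) ≡ ∏< n (λ j → φ (Λ n j) (Λ n (suc j))) * (inv (k q t) ^ n)
    bottom-row = begin
      ∏< n (λ j → Y n j)                                        ≡⟨ ∏<-cong n one-cell ⟩
      ∏< n (λ j → φ (Λ n j) (Λ n (suc j)) * inv K)              ≡⟨ ∏<-* n _ _ ⟩
      ∏< n (λ j → φ (Λ n j) (Λ n (suc j))) * ∏< n (λ _ → inv K) ≡⟨ cong (∏< n (λ j → φ (Λ n j) (Λ n (suc j))) *_) (∏<-const n (inv K)) ⟩
      ∏< n (λ j → φ (Λ n j) (Λ n (suc j))) * (inv K ^ n)        ∎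
      where
      K : ℚ
      K = k q t
      one-cell : ∀ j → j < n → Y n j ≡ φ (Λ n j) (Λ n (suc j)) * inv K
      one-cell j j<n rewrite Λ-bottom-size j<n | Λ-bottom-size (ℕ.<⇒≤ j<n) | ℕ.m+n∸n≡m 1 j = *-identityʳ _

    growth-identity : (k q t ^ n) * grid n S ≡ grid n S̄ * ∏< n (λ i → X i n) * ∏< n (λ j → φ (Λ n j) (Λ n (suc j)))
    growth-identity = begin
      (K ^ n) * grid n S                                  ≡⟨ cong ((K ^ n) *_) growth-telescope ⟩
      (K ^ n) * (grid n S̄ * (∂X * ∏< n (λ j → Y n j)))   ≡⟨ cong (λ z → (K ^ n) * (grid n S̄ * (∂X * z))) bottom-row ⟩
      (K ^ n) * (grid n S̄ * (∂X * (∂φ * (inv K ^ n))))   ≡⟨ solve 5 (λ a s x f b → a :* (s :* (x :* (f :* b))) := (s :* x :* f) :* (a :* b)) refl (K ^ n) (grid n S̄) ∂X ∂φ (inv K ^ n) ⟩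
      (grid n S̄ * ∂X * ∂φ) * ((K ^ n) * (inv K ^ n))     ≡⟨ cong ((grid n S̄ * ∂X * ∂φ) *_) powers-cancel ⟩
      (grid n S̄ * ∂X * ∂φ) * 1ℚ                          ≡⟨ *-identityʳ _ ⟩
      grid n S̄ * ∂X * ∂φ                                 ∎
      where
      K ∂X ∂φ : ℚ
      K = k q t
      ∂X = ∏< n (λ i → X i n)
      ∂φ = ∏< n (λ j → φ (Λ n j) (Λ n (suc j)))
      powers-cancel : (K ^ n) * (inv K ^ n) ≡ 1ℚ
      powers-cancel = trans (sym (^-distrib-* K (inv K) n)) (trans (cong (_^ n) (inv-inverseʳ (k≢0 q t generic))) (1^m≡1 n))

lemma4p24 : (n : ℕ) (σ : Permutation′ n) (Λ : ℕ → ℕ → Partition) (q t : ℚ) →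
    Generic q t → IsGrowth n σ Λ →
    let open Weights q t in
    (((1ℚ - t) ÷ (1ℚ - q)) ^ n) * PΛ n Λ
    ≡ P̄Λ n Λ * ψT n (Ptab n Λ) * φT n (Qtab n Λ)
lemma4p24 n σ Λ q t generic growth = begin
  (k q t ^ n) * PΛ n Λ
    ≡⟨ cong ((k q t ^ n) *_) (prodℚ-squares n (corners Psq)) ⟩
  (k q t ^ n) * grid n (λ i j → corners Psq (suc i) (suc j))
    ≡⟨ growth-identity {σ = σ} growth q t generic ⟩
  grid n (λ i j → corners P̄sq (suc i) (suc j)) * ∏< n (λ i → ψ (Λ i n) (Λ (suc i) n)) * ∏< n (λ j → φ (Λ n j) (Λ n (suc j)))
    ≡⟨ sym (cong₂ _*_ (cong₂ _*_ (prodℚ-squares n (corners P̄sq)) (prodℚ-range1 n (λ i → ψ (Λ (i ∸ 1) n) (Λ i n))))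
                      (prodℚ-range1 n (λ j → φ (Λ n (j ∸ 1)) (Λ n j)))) ⟩
  P̄Λ n Λ * ψT n (Ptab n Λ) * φT n (Qtab n Λ)
    ∎
  where
  open Weights q t
  corners : (Partition → Partition → Partition → Partition → ℚ) → ℕ → ℕ → ℚ
  corners w i j = w (Λ (i ∸ 1) (j ∸ 1)) (Λ (i ∸ 1) j) (Λ i (j ∸ 1)) (Λ i j)
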